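{- Let $O,O'$ be terms and $Q$ a bag with $x$ not free in $Q$. If $O\to_o O'$, then for every $L'\in O'\langle Q/x\rangle\{0/x\}$ there exists $L\in O\langle Q/x\rangle\{0/x\}$ such that $L\to_o L'$.
   Context: Resource calculus. Terms: $M ::= x \mid \lambda x.M \mid MP$; resources: $M$ (linear) or $M^{!}$ (reusable); bags are finite multisets of resources, written multiplicatively: $1$ empty, $[N]\cdot P$, $[N^{!}]\cdot P$. Sums are finite formal sums of terms (or bags), $0$ the empty sum; "$L\in\mathbb S$" means $L$ is a summand of $\mathbb S$. Constructors extend linearly to sums: $\lambda x.\sum_iM_i=\sum_i\lambda x.M_i$, $(\sum_iM_i)(\sum_jP_j)=\sum_{i,j}M_iP_j$, $[\sum_iM_i]\cdot\sum_jP_j=\sum_{i,j}[M_i]\cdot P_j$, while $[(\sum_{i=1}^kM_i)^{!}]\cdot\sum_jP_j=\sum_j[M_1^{!},\dots,M_k^{!}]\cdot P_j$. $A\{N/x\}$ is capture-free substitution. Linear substitution: $x\langle N/x\rangle=N$, $y\langle N/x\rangle=0$ ($y\ne x$), $(\lambda y.M)\langle N/x\rangle=\lambda y.M\langle N/x\rangle$, $(MP)\langle N/x\rangle=M\langle N/x\rangle P+MP\langle N/x\rangle$, $1\langle N/x\rangle=0$, $([M]\cdot P)\langle N/x\rangle=[M\langle N/x\rangle]\cdot P+[M]\cdot P\langle N/x\rangle$, $([M^{!}]\cdot P)\langle N/x\rangle=[M\langle N/x\rangle,M^{!}]\cdot P+[M^{!}]\cdot P\langle N/x\rangle$, extended bilinearly.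 $A\langle N^{!}/x\rangle:=A\{N+x/x\}$, and for a bag $A\langle[N_1^{(!)},\dots,N_n^{(!)}]/x\rangle:=A\langle N_1^{(!)}/x\rangle\cdots\langle N_n^{(!)}/x\rangle$. Giant step: $(\lambda x.M)P\to_g M\langle P/x\rangle\{0/x\}$ closed under one-hole contexts; non-deterministic step $M\to_{nd}N$ iff $M\to_gN+\mathbb A$ for some sum $\mathbb A$. Outer non-deterministic reduction $\to_o$: the non-deterministic step applied to a redex not under the scope of any $(\cdot)^{!}$ (closure under linear contexts); this applies to terms and bags. -}

module Defs where

-- Variables are de Bruijn indices; substitutions A⟨N/x⟩, A{S/x} act on the
-- free index x WITHOUT renumbering the other free indices (named-variable
-- behaviour: x simply disappears).  Only the β-step removes a binder and
-- therefore lowers the indices of its body.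

open import Data.Nat using (ℕ; zero; suc; _≡ᵇ_; _<ᵇ_; _∸_)
open import Data.Bool using (Bool; true; false; if_then_else_; _∨_)
open import Data.List using (List; []; _∷_; _++_; map; concatMap)
open import Data.List.Membership.Propositional using (_∈_)

data Resource : Set

data Term : Set where
  var : ℕ → Term
  lam : Term → Term
  app : Term → List Resource → Term

data Resource where
  lin  : Term → Resource
  bang : Term → Resource

-- Bags: finite multisets of resources, represented by lists;
-- the multiset quotient is handled by the structural equivalence _≅_ below.
Bag : Set
Bag = List Resource

-- Finite formal sums are represented by lists of summands ([] is the sum 0).
Sum : Set
Sum = List Term

SumB : Set
SumB = List Bag

data _≅_ : Term → Term → Set
data _≅ᵣ_ : Resource → Resource → Set
data _≅ᵦ_ : Bag → Bag → Set

data _≅_ where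
  var : ∀ {i} → var i ≅ var i
  lam : ∀ {M N} → M ≅ N → lam M ≅ lam N
  app : ∀ {M N P Q} → M ≅ N → P ≅ᵦ Q → app M P ≅ app N Q

data _≅ᵣ_ where
  lin  : ∀ {M N} → M ≅ N → lin M ≅ᵣ lin N
  bang : ∀ {M N} → M ≅ N → bang M ≅ᵣ bang N

data _≅ᵦ_ where
  []    : [] ≅ᵦ []
  _∷_   : ∀ {r s P Q} → r ≅ᵣ s → P ≅ᵦ Q → (r ∷ P) ≅ᵦ (s ∷ Q)
  swap  : ∀ {r s P} → (r ∷ s ∷ P) ≅ᵦ (s ∷ r ∷ P)
  trans : ∀ {P Q R} → P ≅ᵦ Q → Q ≅ᵦ R → P ≅ᵦ R

occ  : ℕ → Term → Bool
occR : ℕ → Resource → Bool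
occB : ℕ → Bag → Bool
occ x (var y)   = y ≡ᵇ x
occ x (lam M)   = occ (suc x) M
occ x (app M P) = occ x M ∨ occB x P
occR x (lin M)  = occ x M
occR x (bang M) = occ x M
occB x []       = false
occB x (r ∷ P)  = occR x r ∨ occB x P

shift  : ℕ → Term → Term
shiftR : ℕ → Resource → Resource
shiftB : ℕ → Bag → Bag
shift c (var y)   = if y <ᵇ c then var y else var (suc y)
shift c (lam M)   = lam (shift (suc c) M)
shift c (app M P) = app (shift c M) (shiftB c P)
shiftR c (lin M)  = lin (shift c M)
shiftR c (bang M) = bang (shift c M)
shiftB c []       = []
shiftB c (r ∷ P)  = shiftR c r ∷ shiftB c P

lower  : ℕ → Term → Term
lowerR : ℕ → Resource → Resource
lowerB : ℕ → Bag → Bag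
lower c (var y)   = if c <ᵇ y then var (y ∸ 1) else var y
lower c (lam M)   = lam (lower (suc c) M)
lower c (app M P) = app (lower c M) (lowerB c P)
lowerR c (lin M)  = lin (lower c M)
lowerR c (bang M) = bang (lower c M)
lowerB c []       = []
lowerB c (r ∷ P)  = lowerR c r ∷ lowerB c P

-- Substitution of a sum S for x, extended multilinearly:  A{S/x}
-- with [(Σᵢ Mᵢ)^!]·P = [M₁^!,…,M_k^!]·P.

sub  : Term → ℕ → Sum → Sum
subB : Bag → ℕ → Sum → SumB
sub (var y) x S   = if y ≡ᵇ x then S else (var y ∷ [])
sub (lam M) x S   = map lam (sub M (suc x) (map (shift 0) S))
sub (app M P) x S = concatMap (λ M' → map (app M') (subB P x S)) (sub M x S)
subB [] x S           = [] ∷ []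
subB (lin M ∷ P) x S  = concatMap (λ M' → map (lin M' ∷_) (subB P x S)) (sub M x S)
subB (bang M ∷ P) x S = map (λ P' → map bang (sub M x S) ++ P') (subB P x S)

lsub  : Term → ℕ → Term → Sum
lsubB : Bag → ℕ → Term → SumB
lsub (var y) x N   = if y ≡ᵇ x then N ∷ [] else []
lsub (lam M) x N   = map lam (lsub M (suc x) (shift 0 N))
lsub (app M P) x N = map (λ M' → app M' P) (lsub M x N) ++ map (app M) (lsubB P x N)
lsubB [] x N           = []
lsubB (lin M ∷ P) x N  = map (λ M' → lin M' ∷ P) (lsub M x N) ++ map (lin M ∷_) (lsubB P x N)
lsubB (bang M ∷ P) x N = map (λ M' → lin M' ∷ bang M ∷ P) (lsub M x N) ++ map (bang M ∷_) (lsubB P x N)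

lsubR : Term → ℕ → Resource → Sum
lsubR A x (lin N)  = lsub A x N
lsubR A x (bang N) = sub A x (N ∷ var x ∷ [])

lsubBag : Term → ℕ → Bag → Sum
lsubBag A x []      = A ∷ []
lsubBag A x (r ∷ P) = concatMap (λ A' → lsubBag A' x P) (lsubR A x r)

substBag0 : Term → ℕ → Bag → Sum
substBag0 A x P = concatMap (λ A' → sub A' x []) (lsubBag A x P)

-- Giant step at the root:  (λx.M)P →g M⟨P/x⟩{0/x}
-- (x is index 0 of the body; P is shifted under the binder, and the
-- result, in which index 0 no longer occurs, is lowered.)

betaSum : Term → Bag → Sum
betaSum M P = map (lower 0) (substBag0 M 0 (shiftB 0 P))

-- Outer non-deterministic reduction: a summand of the giant step fired at a
-- redex in a linear context (hole not under any (·)^!).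
data _→o_ : Term → Term → Set
data _→oᵦ_ : Bag → Bag → Set

data _→o_ where
  β    : ∀ {M P N} → N ∈ betaSum M P → app (lam M) P →o N
  lamᶜ : ∀ {M N} → M →o N → lam M →o lam N
  appˡ : ∀ {M N P} → M →o N → app M P →o app N P
  appʳ : ∀ {M P Q} → P →oᵦ Q → app M P →o app M Q

data _→oᵦ_ where
  here  : ∀ {M N P} → M →o N → (lin M ∷ P) →oᵦ (lin N ∷ P)
  there : ∀ {r P Q} → P →oᵦ Q → (r ∷ P) →oᵦ (r ∷ Q)

module Submission where

-- Induction on Q: O⟨[r]·Q/x⟩{0/x} is the union over A ∈ O⟨r/x⟩ of A⟨Q/x⟩{0/x}. So it suffices that
-- membership in A⟨Q/x⟩{0/x} is invariant under structural equivalence of A (bags are multisets),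
-- and that an outer step O →o O' is simulated through a single linear substitution ⟨N/x⟩ and through
-- a substitution {S/x} (which covers ⟨N^!/x⟩ = {N + x/x} and {0/x}): each summand of the substituted
-- O' is, up to ≅, a reduct of a summand of the substituted O. In the congruence cases the hole is not under (·)^!, so every summand of the substituted
-- context contains exactly one copy of it. At the root, the substitution for x has to be pushed past
-- the substitution M⟨P/y⟩{0/y} performed by the redex: this is where the Leibniz and chain rules for
-- linear substitution and the commutation and composition laws of substitution are needed.

open import Defs
open import Level using (0ℓ)
open import Data.Bool using (true; false; T; _∨_; if_then_else_)
open import Data.Bool.Properties using (∨-assoc; ∨-conicalˡ; ∨-conicalʳ)
open import Data.Empty using (⊥-elim)
open import Data.List using (List; []; _∷_; _++_; map; concatMap)
open import Data.List.Properties
  using (map-∘; map-cong; map-++; map-id; concatMap-cong; concatMap-map; map-concatMap; concatMap-++; ++-assoc; ++-identityʳ)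
open import Data.List.Membership.Propositional using (_∈_; find; lose)
open import Data.List.Membership.Propositional.Properties using (∈-++⁻; ∈-++⁺ˡ; ∈-++⁺ʳ; ∈-map⁺; ∈-map⁻)
import Data.List.Membership.Propositional.Properties as ∈
open import Data.List.Relation.Unary.Any as Any using (here; there)
open import Data.List.Relation.Binary.Pointwise using (Pointwise; []; _∷_)
import Data.List.Relation.Binary.Permutation.Homogeneous as Homogeneous
import Data.List.Relation.Binary.Permutation.Propositional as ↭ₚ
import Data.List.Relation.Binary.Permutation.Propositional.Properties as ↭ₚ
import Data.List.Relation.Binary.Permutation.Setoid as Permutation
import Data.List.Relation.Binary.Permutation.Setoid.Properties as PermutationProperties
open import Data.Nat using (ℕ; suc; pred; _≡ᵇ_; _<ᵇ_; _∸_; _<_; _≤_; z≤n; s≤s)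
open import Data.Nat.Properties
  using (≡ᵇ⇒≡; ≡⇒≡ᵇ; <ᵇ⇒<; <⇒<ᵇ; ≮⇒≥; 1+n≢0; ≤-trans; <-≤-trans; n≤1+n; ≤∧≢⇒<; <⇒≢; >⇒≢; <⇒≱; <⇒≤)
open import Data.Product using (Σ; _×_; _,_)
open import Data.Sum using (_⊎_; inj₁; inj₂)
open import Data.Unit using (tt)
open import Relation.Binary.Bundles using (Setoid)
open import Relation.Binary.Core using (Rel)
open import Relation.Binary.Structures using (IsEquivalence)
open import Relation.Binary.PropositionalEquality
  using (_≡_; _≢_; refl; sym; cong; cong₂; subst) renaming (trans to ≡-trans)

lin∷ : Term → Bag → Bag
lin∷ M P = lin M ∷ P

-- Structural equivalence

≅-refl  : ∀ {M} → M ≅ M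
≅ᵣ-refl : ∀ {r} → r ≅ᵣ r
≅ᵦ-refl : ∀ {P} → P ≅ᵦ P
≅-refl {var i}   = var
≅-refl {lam M}   = lam ≅-refl
≅-refl {app M P} = app ≅-refl ≅ᵦ-refl
≅ᵣ-refl {lin M}  = lin ≅-refl
≅ᵣ-refl {bang M} = bang ≅-refl
≅ᵦ-refl {[]}     = []
≅ᵦ-refl {r ∷ P}  = ≅ᵣ-refl ∷ ≅ᵦ-refl

≅-sym  : ∀ {M N} → M ≅ N → N ≅ M
≅ᵣ-sym : ∀ {r s} → r ≅ᵣ s → s ≅ᵣ r
≅ᵦ-sym : ∀ {P Q} → P ≅ᵦ Q → Q ≅ᵦ P
≅-sym var          = var
≅-sym (lam e)      = lam (≅-sym e)
≅-sym (app e f)    = app (≅-sym e) (≅ᵦ-sym f)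
≅ᵣ-sym (lin e)     = lin (≅-sym e)
≅ᵣ-sym (bang e)    = bang (≅-sym e)
≅ᵦ-sym []          = []
≅ᵦ-sym (e ∷ f)     = ≅ᵣ-sym e ∷ ≅ᵦ-sym f
≅ᵦ-sym swap        = swap
≅ᵦ-sym (trans e f) = trans (≅ᵦ-sym f) (≅ᵦ-sym e)

≅-trans  : ∀ {L M N} → L ≅ M → M ≅ N → L ≅ N
≅ᵣ-trans : ∀ {r s t} → r ≅ᵣ s → s ≅ᵣ t → r ≅ᵣ t
≅-trans var var               = var
≅-trans (lam e) (lam f)       = lam (≅-trans e f)
≅-trans (app e e') (app f f') = app (≅-trans e f) (trans e' f')
≅ᵣ-trans (lin e) (lin f)      = lin (≅-trans e f)
≅ᵣ-trans (bang e) (bang f)    = bang (≅-trans e f)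

instance
  ≅-isEquivalence : IsEquivalence _≅_
  ≅-isEquivalence = record { refl = ≅-refl ; sym = ≅-sym ; trans = ≅-trans }

  ≅ᵣ-isEquivalence : IsEquivalence _≅ᵣ_
  ≅ᵣ-isEquivalence = record { refl = ≅ᵣ-refl ; sym = ≅ᵣ-sym ; trans = ≅ᵣ-trans }

  ≅ᵦ-isEquivalence : IsEquivalence _≅ᵦ_
  ≅ᵦ-isEquivalence = record { refl = ≅ᵦ-refl ; sym = ≅ᵦ-sym ; trans = trans }

setoidOf : ∀ {A : Set} (R : Rel A 0ℓ) → {{IsEquivalence R}} → Setoid 0ℓ 0ℓ
setoidOf {A} R {{isEq}} = record { Carrier = A ; _≈_ = R ; isEquivalence = isEq }

module PermutationOf {A : Set} (R : Rel A 0ℓ) {{_ : IsEquivalence R}} where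
  open Permutation (setoidOf R) public
  open PermutationProperties (setoidOf R) public

_≈_ : Sum → Sum → Set
_≈_ = Homogeneous.Permutation _≅_

_≈ᵦ_ : SumB → SumB → Set
_≈ᵦ_ = Homogeneous.Permutation _≅ᵦ_

module ≈ = PermutationOf _≅_
module ≈ᵦ = PermutationOf _≅ᵦ_
module ↭ᵣ = PermutationOf _≅ᵣ_

-- _≅ᵦ_ is the permutation relation of _≅ᵣ_, so the library's permutation lemmas apply to bags
↭ᵣ⇒≅ᵦ : ∀ {P Q} → P ↭ᵣ.↭ Q → P ≅ᵦ Q
↭ᵣ⇒≅ᵦ (Homogeneous.refl eqs)     = pointwise eqs
  where
  pointwise : ∀ {P Q} → Pointwise _≅ᵣ_ P Q → P ≅ᵦ Q
  pointwise []        = []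
  pointwise (e ∷ eqs) = e ∷ pointwise eqs
↭ᵣ⇒≅ᵦ (Homogeneous.prep e p)     = e ∷ ↭ᵣ⇒≅ᵦ p
↭ᵣ⇒≅ᵦ (Homogeneous.swap e₁ e₂ p) = trans (e₁ ∷ e₂ ∷ ↭ᵣ⇒≅ᵦ p) swap
↭ᵣ⇒≅ᵦ (Homogeneous.trans p q)    = trans (↭ᵣ⇒≅ᵦ p) (↭ᵣ⇒≅ᵦ q)

≅ᵦ⇒↭ᵣ : ∀ {P Q} → P ≅ᵦ Q → P ↭ᵣ.↭ Q
≅ᵦ⇒↭ᵣ []          = ↭ᵣ.↭-refl
≅ᵦ⇒↭ᵣ (e ∷ p)     = ↭ᵣ.prep e (≅ᵦ⇒↭ᵣ p)
≅ᵦ⇒↭ᵣ swap        = ↭ᵣ.↭-swap _ _ ↭ᵣ.↭-refl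
≅ᵦ⇒↭ᵣ (trans p q) = ↭ᵣ.trans (≅ᵦ⇒↭ᵣ p) (≅ᵦ⇒↭ᵣ q)

↭⇒≅ᵦ : ∀ {P Q} → P ↭ₚ.↭ Q → P ≅ᵦ Q
↭⇒≅ᵦ p = ↭ᵣ⇒≅ᵦ (↭ₚ.↭⇒↭ₛ′ ≅ᵣ-isEquivalence p)

≅ᵦ-++ : ∀ {P Q R S} → P ≅ᵦ Q → R ≅ᵦ S → (P ++ R) ≅ᵦ (Q ++ S)
≅ᵦ-++ e f = ↭ᵣ⇒≅ᵦ (↭ᵣ.++⁺ (≅ᵦ⇒↭ᵣ e) (≅ᵦ⇒↭ᵣ f))

≅ᵦ-++ˡ : ∀ P {R S} → R ≅ᵦ S → (P ++ R) ≅ᵦ (P ++ S)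
≅ᵦ-++ˡ P = ≅ᵦ-++ (≅ᵦ-refl {P})

≅ᵦ-shift : ∀ r P R → (r ∷ P ++ R) ≅ᵦ (P ++ r ∷ R)
≅ᵦ-shift r P R = ↭⇒≅ᵦ (↭ₚ.↭-sym (↭ₚ.shift r P R))

≅ᵦ-shifts : ∀ P Q R → (P ++ Q ++ R) ≅ᵦ (Q ++ P ++ R)
≅ᵦ-shifts P Q R = ↭⇒≅ᵦ (↭ₚ.shifts P Q {R})

module _ {A B : Set} {R : Rel A 0ℓ} {R' : Rel B 0ℓ} {{_ : IsEquivalence R}} {{_ : IsEquivalence R'}} where
  private module P = PermutationOf R'

  concatMap⁺ : ∀ {f : A → List B} → (∀ {a b} → R a b → f a P.↭ f b) →
               ∀ {xs ys} → Homogeneous.Permutation R xs ys → concatMap f xs P.↭ concatMap f ys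
  concatMap⁺ h (Homogeneous.refl eqs) = pointwise eqs
    where
    pointwise : ∀ {xs ys} → Pointwise R xs ys → concatMap _ xs P.↭ concatMap _ ys
    pointwise []        = P.↭-refl
    pointwise (e ∷ eqs) = P.++⁺ (h e) (pointwise eqs)
  concatMap⁺ h (Homogeneous.prep e p) = P.++⁺ (h e) (concatMap⁺ h p)
  concatMap⁺ {f} h (Homogeneous.swap {x′ = x′} {y′ = y′} e₁ e₂ p) =
    P.↭-trans (P.++⁺ (h e₁) (P.++⁺ (h e₂) (concatMap⁺ h p))) (P.shifts (f x′) (f y′))
  concatMap⁺ h (Homogeneous.trans p q) = P.↭-trans (concatMap⁺ h p) (concatMap⁺ h q)

  map⁺ : ∀ {f : A → B} → (∀ {a b} → R a b → R' (f a) (f b)) →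
         ∀ {xs ys} → Homogeneous.Permutation R xs ys → map f xs P.↭ map f ys
  map⁺ = PermutationProperties.map⁺ (setoidOf R) (setoidOf R')

module _ {A B : Set} {R' : Rel B 0ℓ} {{_ : IsEquivalence R'}} where
  private module P = PermutationOf R'

  concatMap-pointwise : ∀ {f g : A → List B} → (∀ a → f a P.↭ g a) → ∀ xs → concatMap f xs P.↭ concatMap g xs
  concatMap-pointwise h []       = P.↭-refl
  concatMap-pointwise h (x ∷ xs) = P.++⁺ (h x) (concatMap-pointwise h xs)

  map-pointwise : ∀ {f g : A → B} → (∀ a → R' (f a) (g a)) → ∀ xs → map f xs P.↭ map g xs
  map-pointwise h []       = P.↭-refl
  map-pointwise h (x ∷ xs) = P.prep (h x) (map-pointwise h xs)

module _ {A : Set} {R : Rel A 0ℓ} {{isEq : IsEquivalence R}} where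
  private module P = PermutationOf R

  ↭ₚ⇒↭ : ∀ {xs ys} → xs ↭ₚ.↭ ys → xs P.↭ ys
  ↭ₚ⇒↭ = ↭ₚ.↭⇒↭ₛ′ isEq

  ∈-resp-↭ : ∀ {x xs ys} → x ∈ xs → xs P.↭ ys → Σ A (λ y → y ∈ ys × R x y)
  ∈-resp-↭ x∈xs p = find (P.∈-resp-↭ p (Any.map (λ { refl → IsEquivalence.refl isEq }) x∈xs))

module _ {A B : Set} where
  ∈-concatMap⁺ : ∀ (f : A → List B) {xs x y} → x ∈ xs → y ∈ f x → y ∈ concatMap f xs
  ∈-concatMap⁺ f x∈xs y∈fx = ∈.∈-concatMap⁺ f (lose x∈xs y∈fx)

  ∈-concatMap⁻ : ∀ (f : A → List B) xs {y} → y ∈ concatMap f xs → Σ A (λ x → x ∈ xs × y ∈ f x)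
  ∈-concatMap⁻ f xs y∈ = find (∈.∈-concatMap⁻ f {xs} y∈)

  concatMap-assoc : ∀ {C : Set} (f : B → List C) (g : A → List B) xs →
                    concatMap f (concatMap g xs) ≡ concatMap (λ x → concatMap f (g x)) xs
  concatMap-assoc f g []       = refl
  concatMap-assoc f g (x ∷ xs) =
    ≡-trans (concatMap-++ f (g x) (concatMap g xs)) (cong (concatMap f (g x) ++_) (concatMap-assoc f g xs))

  concatMap-↭ : ∀ {f g : A → List B} → (∀ a → f a ↭ₚ.↭ g a) → ∀ xs → concatMap f xs ↭ₚ.↭ concatMap g xs
  concatMap-↭ h []       = ↭ₚ.↭-refl
  concatMap-↭ h (x ∷ xs) = ↭ₚ.++⁺ (h x) (concatMap-↭ h xs)

  concatMap-++-↭ : ∀ (f g : A → List B) xs → concatMap (λ x → f x ++ g x) xs ↭ₚ.↭ concatMap f xs ++ concatMap g xs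
  concatMap-++-↭ f g []       = ↭ₚ.↭-refl
  concatMap-++-↭ f g (x ∷ xs) = begin
    (f x ++ g x) ++ concatMap (λ x → f x ++ g x) xs  ↭⟨ ↭ₚ.++⁺ˡ (f x ++ g x) (concatMap-++-↭ f g xs) ⟩
    (f x ++ g x) ++ concatMap f xs ++ concatMap g xs  ≡⟨ ++-assoc (f x) (g x) _ ⟩
    f x ++ g x ++ concatMap f xs ++ concatMap g xs    ↭⟨ ↭ₚ.++⁺ˡ (f x) (↭ₚ.shifts (g x) (concatMap f xs)) ⟩
    f x ++ concatMap f xs ++ g x ++ concatMap g xs    ≡⟨ ++-assoc (f x) (concatMap f xs) _ ⟨
    (f x ++ concatMap f xs) ++ g x ++ concatMap g xs  ∎
    where open ↭ₚ.PermutationReasoning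

module _ {A B C : Set} where
  concatMap-comm-↭ : ∀ (h : A → B → List C) xs ys →
    concatMap (λ a → concatMap (h a) ys) xs ↭ₚ.↭ concatMap (λ b → concatMap (λ a → h a b) xs) ys
  concatMap-comm-↭ h [] ys = ↭ₚ.↭-reflexive (sym (concatMap-nil ys))
    where
    concatMap-nil : ∀ (ys : List B) → concatMap {B = C} (λ _ → []) ys ≡ []
    concatMap-nil []       = refl
    concatMap-nil (y ∷ ys) = concatMap-nil ys
  concatMap-comm-↭ h (x ∷ xs) ys =
    ↭ₚ.↭-trans (↭ₚ.++⁺ˡ (concatMap (h x) ys) (concatMap-comm-↭ h xs ys))
               (↭ₚ.↭-sym (concatMap-++-↭ (h x) (λ b → concatMap (λ a → h a b) xs) ys))

  productWith : (A → B → C) → List A → List B → List C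
  productWith f X Y = concatMap (λ a → map (f a) Y) X

  ∈-productWith⁺ : ∀ (f : A → B → C) {X Y a b} → a ∈ X → b ∈ Y → f a b ∈ productWith f X Y
  ∈-productWith⁺ f {X} {Y} a∈X b∈Y = ∈-concatMap⁺ (λ a → map (f a) Y) a∈X (∈-map⁺ (f _) b∈Y)

  ∈-productWith⁻ : ∀ (f : A → B → C) X Y {c} → c ∈ productWith f X Y →
                   Σ A (λ a → a ∈ X × Σ B (λ b → b ∈ Y × c ≡ f a b))
  ∈-productWith⁻ f X Y c∈ with ∈-concatMap⁻ (λ a → map (f a) Y) X c∈
  ... | a , a∈X , c∈fa with ∈-map⁻ (f a) c∈fa
  ... | b , b∈Y , refl = a , a∈X , b , b∈Y , refl

  productWith-concatMap-↭ : ∀ (f : A → B → C) (g : C → List C) (F : A → List A) (G : B → List B) →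
    (∀ a b → g (f a b) ≡ productWith f (F a) (G b)) → ∀ X Y →
    concatMap g (productWith f X Y) ↭ₚ.↭ productWith f (concatMap F X) (concatMap G Y)
  productWith-concatMap-↭ f g F G h X Y = begin
    concatMap g (productWith f X Y)
      ≡⟨ ≡-trans (concatMap-assoc g (λ a → map (f a) Y) X)
                 (concatMap-cong (λ a → ≡-trans (concatMap-map g (f a) Y) (concatMap-cong (h a) Y)) X) ⟩
    concatMap (λ a → concatMap (λ b → productWith f (F a) (G b)) Y) X
      ↭⟨ concatMap-↭ (λ a → ↭ₚ.↭-sym (concatMap-comm-↭ (λ a' b → map (f a') (G b)) (F a) Y)) X ⟩
    concatMap (λ a → concatMap (λ a' → concatMap (λ b → map (f a') (G b)) Y) (F a)) X
      ≡⟨ ≡-trans (concatMap-assoc (λ a' → map (f a') (concatMap G Y)) F X)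
                 (concatMap-cong (λ a → concatMap-cong (λ a' → map-concatMap (f a') G Y) (F a)) X) ⟨
    productWith f (concatMap F X) (concatMap G Y) ∎
    where open ↭ₚ.PermutationReasoning

productWith-map : ∀ {A A' B B' C : Set} (f : A → B → C) (g : A' → A) (h : B' → B) X Y →
                  productWith f (map g X) (map h Y) ≡ productWith (λ a b → f (g a) (h b)) X Y
productWith-map f g h X Y = ≡-trans (concatMap-map _ g X) (concatMap-cong (λ a → sym (map-∘ Y)) X)

map-productWith : ∀ {A B C D : Set} (k : C → D) (f : A → B → C) X Y →
                  map k (productWith f X Y) ≡ productWith (λ a b → k (f a b)) X Y
map-productWith k f X Y = ≡-trans (map-concatMap k _ X) (concatMap-cong (λ a → sym (map-∘ Y)) X)

module _ {A B C : Set} {R₁ : Rel A 0ℓ} {R₂ : Rel B 0ℓ} {R₃ : Rel C 0ℓ}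
         {{isEq₁ : IsEquivalence R₁}} {{isEq₂ : IsEquivalence R₂}} {{_ : IsEquivalence R₃}} where
  private module P₃ = PermutationOf R₃

  productWith⁺ : ∀ (f : A → B → C) → (∀ {a a' b b'} → R₁ a a' → R₂ b b' → R₃ (f a b) (f a' b')) →
    ∀ {X X' Y Y'} → Homogeneous.Permutation R₁ X X' → Homogeneous.Permutation R₂ Y Y' →
    productWith f X Y P₃.↭ productWith f X' Y'
  productWith⁺ f f-cong {X} {X'} {Y} p q =
    P₃.↭-trans (concatMap⁺ (λ e → map-pointwise (λ b → f-cong e (IsEquivalence.refl isEq₂)) Y) p)
               (concatMap-pointwise (λ a → map⁺ (f-cong (IsEquivalence.refl isEq₁)) q) X')

-- Index arithmetic

data ≡ᵇ-View (y x : ℕ) : Set where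
  eq : y ≡ x → (y ≡ᵇ x) ≡ true → ≡ᵇ-View y x
  ne : y ≢ x → (y ≡ᵇ x) ≡ false → ≡ᵇ-View y x

≡ᵇ-view : ∀ y x → ≡ᵇ-View y x
≡ᵇ-view y x with y ≡ᵇ x in e
... | true  = eq (≡ᵇ⇒≡ y x (subst T (sym e) tt)) e
... | false = ne (λ p → subst T e (≡⇒≡ᵇ y x p)) e

data <ᵇ-View (z c : ℕ) : Set where
  lt : z < c → (z <ᵇ c) ≡ true → <ᵇ-View z c
  ge : c ≤ z → (z <ᵇ c) ≡ false → <ᵇ-View z c

<ᵇ-view : ∀ z c → <ᵇ-View z c
<ᵇ-view z c with z <ᵇ c in e
... | true  = lt (<ᵇ⇒< z c (subst T (sym e) tt)) e
... | false = ge (≮⇒≥ (λ p → subst T e (<⇒<ᵇ p))) e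

≡ᵇ-refl : ∀ y → (y ≡ᵇ y) ≡ true
≡ᵇ-refl y with ≡ᵇ-view y y
... | eq _ e   = e
... | ne y≢y _ = ⊥-elim (y≢y refl)

≢⇒≡ᵇ-false : ∀ {y x} → y ≢ x → (y ≡ᵇ x) ≡ false
≢⇒≡ᵇ-false {y} {x} y≢x with ≡ᵇ-view y x
... | eq y≡x _ = ⊥-elim (y≢x y≡x)
... | ne _ e   = e

<⇒≡ᵇ-false : ∀ {y x} → y < x → (y ≡ᵇ x) ≡ false
<⇒≡ᵇ-false y<x = ≢⇒≡ᵇ-false (<⇒≢ y<x)

≤∧≡ᵇ-false⇒< : ∀ {z c} → z ≤ c → (z ≡ᵇ c) ≡ false → z < c
≤∧≡ᵇ-false⇒< {z} {c} z≤c e with ≡ᵇ-view z c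
... | ne z≢c _ = ≤∧≢⇒< z≤c z≢c
... | eq _ e' with ≡-trans (sym e') e
...   | ()

<ᵇ-true : ∀ {m n} → m < n → (m <ᵇ n) ≡ true
<ᵇ-true {m} {n} m<n with <ᵇ-view m n
... | lt _ e   = e
... | ge n≤m _ = ⊥-elim (<⇒≱ m<n n≤m)

<ᵇ-false : ∀ {m n} → n ≤ m → (m <ᵇ n) ≡ false
<ᵇ-false {m} {n} n≤m with <ᵇ-view m n
... | lt m<n _ = ⊥-elim (<⇒≱ m<n n≤m)
... | ge _ e   = e

shiftVar : ℕ → ℕ → ℕ
shiftVar c z = if z <ᵇ c then z else suc z

lowerVar : ℕ → ℕ → ℕ
lowerVar c z = if c <ᵇ z then z ∸ 1 else z

shift-var : ∀ c z → shift c (var z) ≡ var (shiftVar c z)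
shift-var c z with z <ᵇ c
... | true  = refl
... | false = refl

lower-var : ∀ c z → lower c (var z) ≡ var (lowerVar c z)
lower-var c z with c <ᵇ z
... | true  = refl
... | false = refl

shiftVar-comm : ∀ {c d} → c ≤ d → ∀ z → shiftVar (suc d) (shiftVar c z) ≡ shiftVar c (shiftVar d z)
shiftVar-comm {c} {d} c≤d z with <ᵇ-view z c
... | lt z<c e rewrite e | <ᵇ-true (<-≤-trans z<c (≤-trans c≤d (n≤1+n d))) | <ᵇ-true (<-≤-trans z<c c≤d) | e = refl
... | ge c≤z e rewrite e with <ᵇ-view z d
...   | lt _ e' rewrite e' | e = refl
...   | ge _ e' rewrite e' | <ᵇ-false {suc z} (≤-trans c≤z (n≤1+n z)) = refl

lowerVar-shiftVar : ∀ c z → lowerVar c (shiftVar c z) ≡ z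
lowerVar-shiftVar c z with <ᵇ-view z c
... | lt z<c e rewrite e | <ᵇ-false {c} {z} (<⇒≤ z<c) = refl
... | ge c≤z e rewrite e | <ᵇ-true {c} {suc z} (s≤s c≤z) = refl

shiftVar-≡ᵇ : ∀ {c x} → c ≤ x → ∀ z → (shiftVar c z ≡ᵇ suc x) ≡ (z ≡ᵇ x)
shiftVar-≡ᵇ {c} {x} c≤x z with <ᵇ-view z c
... | lt z<c e rewrite e | <⇒≡ᵇ-false (<-≤-trans z<c (≤-trans c≤x (n≤1+n x))) | <⇒≡ᵇ-false (<-≤-trans z<c c≤x) = refl
... | ge _ e rewrite e = refl

shiftVar-≢ : ∀ c z → (shiftVar c z ≡ᵇ c) ≡ false
shiftVar-≢ c z with <ᵇ-view z c
... | lt z<c e rewrite e = <⇒≡ᵇ-false z<c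
... | ge c≤z e rewrite e = ≢⇒≡ᵇ-false (>⇒≢ (s≤s c≤z))

lowerVar-≡ᵇ : ∀ {c x} → c ≤ x → ∀ z → (z ≡ᵇ c) ≡ false → (lowerVar c z ≡ᵇ x) ≡ (z ≡ᵇ suc x)
lowerVar-≡ᵇ {c} c≤x z z≢c with <ᵇ-view c z
lowerVar-≡ᵇ c≤x (suc z) z≢c | lt _ e rewrite e = refl
lowerVar-≡ᵇ {c} {x} c≤x z z≢c | ge z≤c e rewrite e with ≤∧≡ᵇ-false⇒< z≤c z≢c
... | z<c rewrite <⇒≡ᵇ-false (<-≤-trans z<c c≤x) | <⇒≡ᵇ-false (<-≤-trans z<c (≤-trans c≤x (n≤1+n x))) = refl

shift-comm  : ∀ {c d} → c ≤ d → ∀ t → shift (suc d) (shift c t) ≡ shift c (shift d t)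
shiftR-comm : ∀ {c d} → c ≤ d → ∀ r → shiftR (suc d) (shiftR c r) ≡ shiftR c (shiftR d r)
shiftB-comm : ∀ {c d} → c ≤ d → ∀ P → shiftB (suc d) (shiftB c P) ≡ shiftB c (shiftB d P)
shift-comm {c} {d} c≤d (var z)
  rewrite shift-var c z | shift-var d z | shift-var (suc d) (shiftVar c z) | shift-var c (shiftVar d z) =
  cong var (shiftVar-comm c≤d z)
shift-comm c≤d (lam t)       = cong lam (shift-comm (s≤s c≤d) t)
shift-comm c≤d (app t P)     = cong₂ app (shift-comm c≤d t) (shiftB-comm c≤d P)
shiftR-comm c≤d (lin t)      = cong lin (shift-comm c≤d t)
shiftR-comm c≤d (bang t)     = cong bang (shift-comm c≤d t)
shiftB-comm c≤d []           = refl
shiftB-comm c≤d (r ∷ P)      = cong₂ _∷_ (shiftR-comm c≤d r) (shiftB-comm c≤d P)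

lower-shift  : ∀ c t → lower c (shift c t) ≡ t
lowerR-shift : ∀ c r → lowerR c (shiftR c r) ≡ r
lowerB-shift : ∀ c P → lowerB c (shiftB c P) ≡ P
lower-shift c (var z) rewrite shift-var c z | lower-var c (shiftVar c z) = cong var (lowerVar-shiftVar c z)
lower-shift c (lam t)    = cong lam (lower-shift (suc c) t)
lower-shift c (app t P)  = cong₂ app (lower-shift c t) (lowerB-shift c P)
lowerR-shift c (lin t)   = cong lin (lower-shift c t)
lowerR-shift c (bang t)  = cong bang (lower-shift c t)
lowerB-shift c []        = refl
lowerB-shift c (r ∷ P)   = cong₂ _∷_ (lowerR-shift c r) (lowerB-shift c P)

map-lower-shift : ∀ c S → map (lower c) (map (shift c) S) ≡ S
map-lower-shift c []      = refl
map-lower-shift c (s ∷ S) = cong₂ _∷_ (lower-shift c s) (map-lower-shift c S)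

map²-cong : ∀ {A B B' C : Set} (f : B → C) (g : A → B) (f' : B' → C) (g' : A → B') xs →
            (∀ a → f (g a) ≡ f' (g' a)) → map f (map g xs) ≡ map f' (map g' xs)
map²-cong f g f' g' xs h = ≡-trans (sym (map-∘ xs)) (≡-trans (map-cong h xs) (map-∘ xs))

map-shift-shift : ∀ c S → map (shift 0) (map (shift c) S) ≡ map (shift (suc c)) (map (shift 0) S)
map-shift-shift c S = map²-cong _ _ _ _ S (λ a → sym (shift-comm z≤n a))

shiftB-bangs-++ : ∀ c X P → shiftB c (map bang X ++ P) ≡ map bang (map (shift c) X) ++ shiftB c P
shiftB-bangs-++ c [] P      = refl
shiftB-bangs-++ c (x ∷ X) P = cong (bang (shift c x) ∷_) (shiftB-bangs-++ c X P)

lowerB-bangs-++ : ∀ c X P → lowerB c (map bang X ++ P) ≡ map bang (map (lower c) X) ++ lowerB c P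
lowerB-bangs-++ c [] P      = refl
lowerB-bangs-++ c (x ∷ X) P = cong (bang (lower c x) ∷_) (lowerB-bangs-++ c X P)

∨-false⁻ : ∀ {a b} → (a ∨ b) ≡ false → (a ≡ false) × (b ≡ false)
∨-false⁻ {a} {b} e = ∨-conicalˡ a b e , ∨-conicalʳ a b e

occB-++ : ∀ x P Q → occB x (P ++ Q) ≡ (occB x P ∨ occB x Q)
occB-++ x [] Q      = refl
occB-++ x (r ∷ P) Q = ≡-trans (cong (occR x r ∨_) (occB-++ x P Q)) (sym (∨-assoc (occR x r) (occB x P) (occB x Q)))

occB-bangs : ∀ x Ms → (∀ {M} → M ∈ Ms → occ x M ≡ false) → occB x (map bang Ms) ≡ false
occB-bangs x [] fresh       = refl
occB-bangs x (M ∷ Ms) fresh rewrite fresh (here refl) = occB-bangs x Ms (λ M∈ → fresh (there M∈))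

occ-shift  : ∀ {c x} → c ≤ x → ∀ t → occ (suc x) (shift c t) ≡ occ x t
occR-shift : ∀ {c x} → c ≤ x → ∀ r → occR (suc x) (shiftR c r) ≡ occR x r
occB-shift : ∀ {c x} → c ≤ x → ∀ P → occB (suc x) (shiftB c P) ≡ occB x P
occ-shift {c} c≤x (var z) rewrite shift-var c z = shiftVar-≡ᵇ c≤x z
occ-shift c≤x (lam t)    = occ-shift (s≤s c≤x) t
occ-shift c≤x (app t P)  = cong₂ _∨_ (occ-shift c≤x t) (occB-shift c≤x P)
occR-shift c≤x (lin t)   = occ-shift c≤x t
occR-shift c≤x (bang t)  = occ-shift c≤x t
occB-shift c≤x []        = refl
occB-shift c≤x (r ∷ P)   = cong₂ _∨_ (occR-shift c≤x r) (occB-shift c≤x P)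

occ-shift-self  : ∀ c t → occ c (shift c t) ≡ false
occR-shift-self : ∀ c r → occR c (shiftR c r) ≡ false
occB-shift-self : ∀ c P → occB c (shiftB c P) ≡ false
occ-shift-self c (var z) rewrite shift-var c z = shiftVar-≢ c z
occ-shift-self c (lam t) = occ-shift-self (suc c) t
occ-shift-self c (app t P) rewrite occ-shift-self c t | occB-shift-self c P = refl
occR-shift-self c (lin t)  = occ-shift-self c t
occR-shift-self c (bang t) = occ-shift-self c t
occB-shift-self c [] = refl
occB-shift-self c (r ∷ P) rewrite occR-shift-self c r | occB-shift-self c P = refl

shift₀-fresh : ∀ {y} S → (∀ {s} → s ∈ S → occ y s ≡ false) → ∀ {s} → s ∈ map (shift 0) S → occ (suc y) s ≡ false
shift₀-fresh {y} S fresh s∈ with ∈-map⁻ (shift 0) s∈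
... | s , s∈S , refl = ≡-trans (occ-shift z≤n s) (fresh s∈S)

shift₀-avoids-0 : ∀ S {s} → s ∈ map (shift 0) S → occ 0 s ≡ false
shift₀-avoids-0 S s∈ with ∈-map⁻ (shift 0) s∈
... | s , _ , refl = occ-shift-self 0 s

sub-fresh  : ∀ {x} A S → occ x A ≡ false → sub A x S ≡ A ∷ []
subB-fresh : ∀ {x} P S → occB x P ≡ false → subB P x S ≡ P ∷ []
sub-fresh (var y) S x∉ rewrite x∉ = refl
sub-fresh (lam A) S x∉ rewrite sub-fresh A (map (shift 0) S) x∉ = refl
sub-fresh {x} (app A P) S x∉ with ∨-false⁻ {occ x A} x∉
... | x∉A , x∉P rewrite sub-fresh A S x∉A | subB-fresh P S x∉P = refl
subB-fresh [] S x∉ = refl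
subB-fresh {x} (lin M ∷ P) S x∉ with ∨-false⁻ {occ x M} x∉
... | x∉M , x∉P rewrite sub-fresh M S x∉M | subB-fresh P S x∉P = refl
subB-fresh {x} (bang M ∷ P) S x∉ with ∨-false⁻ {occ x M} x∉
... | x∉M , x∉P rewrite sub-fresh M S x∉M | subB-fresh P S x∉P = refl

sub-var-≢ : ∀ {z x} S → z ≢ x → sub (var z) x S ≡ var z ∷ []
sub-var-≢ S z≢x rewrite ≢⇒≡ᵇ-false z≢x = refl

-- Substitution versus shifting and lowering

lsub-shift  : ∀ {c x} → c ≤ x → ∀ A N → lsub (shift c A) (suc x) (shift c N) ≡ map (shift c) (lsub A x N)
lsubB-shift : ∀ {c x} → c ≤ x → ∀ P N → lsubB (shiftB c P) (suc x) (shift c N) ≡ map (shiftB c) (lsubB P x N)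
lsub-shift {c} {x} c≤x (var z) N rewrite shift-var c z | shiftVar-≡ᵇ c≤x z with z ≡ᵇ x
... | true  = refl
... | false = refl
lsub-shift {c} {x} c≤x (lam A) N
  rewrite sym (shift-comm (z≤n {c}) N) | lsub-shift (s≤s c≤x) A (shift 0 N) =
  map²-cong lam (shift (suc c)) (shift c) lam (lsub A (suc x) (shift 0 N)) (λ _ → refl)
lsub-shift {c} {x} c≤x (app M P) N
  rewrite lsub-shift c≤x M N | lsubB-shift c≤x P N
        | map-++ (shift c) (map (λ M' → app M' P) (lsub M x N)) (map (app M) (lsubB P x N)) =
  cong₂ _++_ (map²-cong _ (shift c) (shift c) _ (lsub M x N) (λ _ → refl))
             (map²-cong _ (shiftB c) (shift c) _ (lsubB P x N) (λ _ → refl))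
lsubB-shift c≤x [] N = refl
lsubB-shift {c} {x} c≤x (lin M ∷ P) N
  rewrite lsub-shift c≤x M N | lsubB-shift c≤x P N
        | map-++ (shiftB c) (map (λ M' → lin M' ∷ P) (lsub M x N)) (map (lin M ∷_) (lsubB P x N)) =
  cong₂ _++_ (map²-cong _ (shift c) (shiftB c) _ (lsub M x N) (λ _ → refl))
             (map²-cong _ (shiftB c) (shiftB c) _ (lsubB P x N) (λ _ → refl))
lsubB-shift {c} {x} c≤x (bang M ∷ P) N
  rewrite lsub-shift c≤x M N | lsubB-shift c≤x P N
        | map-++ (shiftB c) (map (λ M' → lin M' ∷ bang M ∷ P) (lsub M x N)) (map (bang M ∷_) (lsubB P x N)) =
  cong₂ _++_ (map²-cong _ (shift c) (shiftB c) _ (lsub M x N) (λ _ → refl))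
             (map²-cong _ (shiftB c) (shiftB c) _ (lsubB P x N) (λ _ → refl))

sub-shift  : ∀ {c x} → c ≤ x → ∀ A S → sub (shift c A) (suc x) (map (shift c) S) ≡ map (shift c) (sub A x S)
subB-shift : ∀ {c x} → c ≤ x → ∀ P S → subB (shiftB c P) (suc x) (map (shift c) S) ≡ map (shiftB c) (subB P x S)
sub-shift {c} {x} c≤x (var z) S rewrite shift-var c z | shiftVar-≡ᵇ c≤x z with z ≡ᵇ x
... | true  = refl
... | false = cong (_∷ []) (sym (shift-var c z))
sub-shift {c} {x} c≤x (lam A) S rewrite map-shift-shift c S | sub-shift (s≤s c≤x) A (map (shift 0) S) =
  map²-cong lam (shift (suc c)) (shift c) lam (sub A (suc x) (map (shift 0) S)) (λ _ → refl)
sub-shift {c} {x} c≤x (app M P) S rewrite sub-shift c≤x M S | subB-shift c≤x P S =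
  ≡-trans (productWith-map app (shift c) (shiftB c) (sub M x S) (subB P x S))
          (sym (map-productWith (shift c) app (sub M x S) (subB P x S)))
subB-shift c≤x [] S = refl
subB-shift {c} {x} c≤x (lin M ∷ P) S rewrite sub-shift c≤x M S | subB-shift c≤x P S =
  ≡-trans (productWith-map lin∷ (shift c) (shiftB c) (sub M x S) (subB P x S))
          (sym (map-productWith (shiftB c) lin∷ (sub M x S) (subB P x S)))
subB-shift {c} {x} c≤x (bang M ∷ P) S rewrite sub-shift c≤x M S | subB-shift c≤x P S =
  map²-cong _ _ _ _ (subB P x S) (λ P' → sym (shiftB-bangs-++ c (sub M x S) P'))

lsub-lower  : ∀ {c x} → c ≤ x → ∀ t N → occ c t ≡ false →
              lsub (lower c t) x N ≡ map (lower c) (lsub t (suc x) (shift c N))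
lsubB-lower : ∀ {c x} → c ≤ x → ∀ P N → occB c P ≡ false →
              lsubB (lowerB c P) x N ≡ map (lowerB c) (lsubB P (suc x) (shift c N))
lsub-lower {c} {x} c≤x (var z) N c∉ rewrite lower-var c z | lowerVar-≡ᵇ c≤x z c∉ with z ≡ᵇ suc x
... | true  = cong (_∷ []) (sym (lower-shift c N))
... | false = refl
lsub-lower {c} {x} c≤x (lam t) N c∉
  rewrite lsub-lower (s≤s c≤x) t (shift 0 N) c∉ | shift-comm (z≤n {c}) N =
  map²-cong lam (lower (suc c)) (lower c) lam (lsub t (suc (suc x)) (shift 0 (shift c N))) (λ _ → refl)
lsub-lower {c} {x} c≤x (app M P) N c∉ with ∨-false⁻ {occ c M} c∉
... | c∉M , c∉P
  rewrite lsub-lower c≤x M N c∉M | lsubB-lower c≤x P N c∉P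
        | map-++ (lower c) (map (λ M' → app M' P) (lsub M (suc x) (shift c N))) (map (app M) (lsubB P (suc x) (shift c N))) =
  cong₂ _++_ (map²-cong _ (lower c) (lower c) _ (lsub M (suc x) (shift c N)) (λ _ → refl))
             (map²-cong _ (lowerB c) (lower c) _ (lsubB P (suc x) (shift c N)) (λ _ → refl))
lsubB-lower c≤x [] N c∉ = refl
lsubB-lower {c} {x} c≤x (lin M ∷ P) N c∉ with ∨-false⁻ {occ c M} c∉
... | c∉M , c∉P
  rewrite lsub-lower c≤x M N c∉M | lsubB-lower c≤x P N c∉P
        | map-++ (lowerB c) (map (λ M' → lin M' ∷ P) (lsub M (suc x) (shift c N))) (map (lin M ∷_) (lsubB P (suc x) (shift c N))) =
  cong₂ _++_ (map²-cong _ (lower c) (lowerB c) _ (lsub M (suc x) (shift c N)) (λ _ → refl))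
             (map²-cong _ (lowerB c) (lowerB c) _ (lsubB P (suc x) (shift c N)) (λ _ → refl))
lsubB-lower {c} {x} c≤x (bang M ∷ P) N c∉ with ∨-false⁻ {occ c M} c∉
... | c∉M , c∉P
  rewrite lsub-lower c≤x M N c∉M | lsubB-lower c≤x P N c∉P
        | map-++ (lowerB c) (map (λ M' → lin M' ∷ bang M ∷ P) (lsub M (suc x) (shift c N)))
                            (map (bang M ∷_) (lsubB P (suc x) (shift c N))) =
  cong₂ _++_ (map²-cong _ (lower c) (lowerB c) _ (lsub M (suc x) (shift c N)) (λ _ → refl))
             (map²-cong _ (lowerB c) (lowerB c) _ (lsubB P (suc x) (shift c N)) (λ _ → refl))

sub-lower  : ∀ {c x} → c ≤ x → ∀ t S → occ c t ≡ false →
             sub (lower c t) x S ≡ map (lower c) (sub t (suc x) (map (shift c) S))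
subB-lower : ∀ {c x} → c ≤ x → ∀ P S → occB c P ≡ false →
             subB (lowerB c P) x S ≡ map (lowerB c) (subB P (suc x) (map (shift c) S))
sub-lower {c} {x} c≤x (var z) S c∉ rewrite lower-var c z | lowerVar-≡ᵇ c≤x z c∉ with z ≡ᵇ suc x
... | true  = sym (map-lower-shift c S)
... | false = cong (_∷ []) (sym (lower-var c z))
sub-lower {c} {x} c≤x (lam t) S c∉ rewrite sub-lower (s≤s c≤x) t (map (shift 0) S) c∉ | map-shift-shift c S =
  map²-cong lam (lower (suc c)) (lower c) lam (sub t (suc (suc x)) (map (shift (suc c)) (map (shift 0) S))) (λ _ → refl)
sub-lower {c} {x} c≤x (app M P) S c∉ with ∨-false⁻ {occ c M} c∉
... | c∉M , c∉P rewrite sub-lower c≤x M S c∉M | subB-lower c≤x P S c∉P =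
  ≡-trans (productWith-map app (lower c) (lowerB c) (sub M (suc x) S') (subB P (suc x) S'))
          (sym (map-productWith (lower c) app (sub M (suc x) S') (subB P (suc x) S')))
  where S' = map (shift c) S
subB-lower c≤x [] S c∉ = refl
subB-lower {c} {x} c≤x (lin M ∷ P) S c∉ with ∨-false⁻ {occ c M} c∉
... | c∉M , c∉P rewrite sub-lower c≤x M S c∉M | subB-lower c≤x P S c∉P =
  ≡-trans (productWith-map lin∷ (lower c) (lowerB c) (sub M (suc x) S') (subB P (suc x) S'))
          (sym (map-productWith (lowerB c) lin∷ (sub M (suc x) S') (subB P (suc x) S')))
  where S' = map (shift c) S
subB-lower {c} {x} c≤x (bang M ∷ P) S c∉ with ∨-false⁻ {occ c M} c∉
... | c∉M , c∉P rewrite sub-lower c≤x M S c∉M | subB-lower c≤x P S c∉P =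
  map²-cong _ _ _ _ (subB P (suc x) (map (shift c) S)) (λ P' → sym (lowerB-bangs-++ c (sub M (suc x) (map (shift c) S)) P'))

occ-sub-self   : ∀ {x S a} A → (∀ {s} → s ∈ S → occ x s ≡ false) → a ∈ sub A x S → occ x a ≡ false
occB-subB-self : ∀ {x S a} P → (∀ {s} → s ∈ S → occ x s ≡ false) → a ∈ subB P x S → occB x a ≡ false
occ-sub-self {x} (var z) x∉S a∈ with ≡ᵇ-view z x
... | eq _ e rewrite e = x∉S a∈
... | ne _ e rewrite e with a∈
...   | here refl = e
occ-sub-self {x} {S} (lam A) x∉S a∈ with ∈-map⁻ lam a∈
... | a , a∈' , refl = occ-sub-self A (shift₀-fresh S x∉S) a∈'
occ-sub-self {x} {S} (app M P) x∉S a∈ with ∈-productWith⁻ app (sub M x S) (subB P x S) a∈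
... | M' , M'∈ , P' , P'∈ , refl rewrite occ-sub-self M x∉S M'∈ | occB-subB-self P x∉S P'∈ = refl
occB-subB-self [] x∉S (here refl) = refl
occB-subB-self {x} {S} (lin M ∷ P) x∉S a∈ with ∈-productWith⁻ lin∷ (sub M x S) (subB P x S) a∈
... | M' , M'∈ , P' , P'∈ , refl rewrite occ-sub-self M x∉S M'∈ | occB-subB-self P x∉S P'∈ = refl
occB-subB-self {x} {S} (bang M ∷ P) x∉S a∈ with ∈-map⁻ _ a∈
... | P' , P'∈ , refl rewrite occB-++ x (map bang (sub M x S)) P'
                            | occB-bangs x (sub M x S) (occ-sub-self M x∉S) | occB-subB-self P x∉S P'∈ = refl

occ-sub   : ∀ {x y S a} A → occ y A ≡ false → (∀ {s} → s ∈ S → occ y s ≡ false) → a ∈ sub A x S → occ y a ≡ false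
occB-subB : ∀ {x y S a} P → occB y P ≡ false → (∀ {s} → s ∈ S → occ y s ≡ false) → a ∈ subB P x S → occB y a ≡ false
occ-sub {x} (var z) y∉A y∉S a∈ with ≡ᵇ-view z x
... | eq _ e rewrite e = y∉S a∈
... | ne _ e rewrite e with a∈
...   | here refl = y∉A
occ-sub {x} {y} {S} (lam A) y∉A y∉S a∈ with ∈-map⁻ lam a∈
... | a , a∈' , refl = occ-sub A y∉A (shift₀-fresh S y∉S) a∈'
occ-sub {x} {y} {S} (app M P) y∉A y∉S a∈ with ∨-false⁻ {occ y M} y∉A
... | y∉M , y∉P with ∈-productWith⁻ app (sub M x S) (subB P x S) a∈
... | M' , M'∈ , P' , P'∈ , refl rewrite occ-sub M y∉M y∉S M'∈ | occB-subB P y∉P y∉S P'∈ = refl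
occB-subB [] y∉A y∉S (here refl) = refl
occB-subB {x} {y} {S} (lin M ∷ P) y∉A y∉S a∈ with ∨-false⁻ {occ y M} y∉A
... | y∉M , y∉P with ∈-productWith⁻ lin∷ (sub M x S) (subB P x S) a∈
... | M' , M'∈ , P' , P'∈ , refl rewrite occ-sub M y∉M y∉S M'∈ | occB-subB P y∉P y∉S P'∈ = refl
occB-subB {x} {y} {S} (bang M ∷ P) y∉A y∉S a∈ with ∨-false⁻ {occ y M} y∉A
... | y∉M , y∉P with ∈-map⁻ _ a∈
... | P' , P'∈ , refl rewrite occB-++ y (map bang (sub M x S)) P'
                            | occB-bangs y (sub M x S) (occ-sub M y∉M y∉S) | occB-subB P y∉P y∉S P'∈ = refl

-- Substitution respects structural equivalence

bangs-cong : ∀ {X Y} → X ≈ Y → map bang X ≅ᵦ map bang Y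
bangs-cong p = ↭ᵣ⇒≅ᵦ (map⁺ bang p)

subR : Resource → ℕ → Sum → SumB
subR (lin M) x S  = map (λ M' → lin M' ∷ []) (sub M x S)
subR (bang M) x S = map bang (sub M x S) ∷ []

subB-∷ : ∀ r P x S → subB (r ∷ P) x S ≡ productWith _++_ (subR r x S) (subB P x S)
subB-∷ (lin M) P x S  = sym (concatMap-map _ _ (sub M x S))
subB-∷ (bang M) P x S = sym (++-identityʳ _)

productWith-++-comm : ∀ As Bs Cs →
  productWith _++_ As (productWith _++_ Bs Cs) ≈ᵦ productWith _++_ Bs (productWith _++_ As Cs)
productWith-++-comm As Bs Cs = begin
  productWith _++_ As (productWith _++_ Bs Cs)                   ≡⟨ triple As Bs ⟩
  concatMap (λ A → concatMap (λ B → map (λ C → A ++ B ++ C) Cs) Bs) As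
    ↭⟨ ↭ₚ⇒↭ (concatMap-comm-↭ (λ A B → map (λ C → A ++ B ++ C) Cs) As Bs) ⟩
  concatMap (λ B → concatMap (λ A → map (λ C → A ++ B ++ C) Cs) As) Bs
    ↭⟨ concatMap-pointwise (λ B → concatMap-pointwise (λ A → map-pointwise (λ C → ≅ᵦ-shifts A B C) Cs) As) Bs ⟩
  concatMap (λ B → concatMap (λ A → map (λ C → B ++ A ++ C) Cs) As) Bs ≡⟨ triple Bs As ⟨
  productWith _++_ Bs (productWith _++_ As Cs)                   ∎
  where
  open ≈ᵦ.PermutationReasoning
  triple : ∀ As Bs → productWith _++_ As (productWith _++_ Bs Cs) ≡
                     concatMap (λ A → concatMap (λ B → map (λ C → A ++ B ++ C) Cs) Bs) As
  triple As Bs = concatMap-cong (λ A → ≡-trans (map-concatMap (A ++_) _ Bs) (concatMap-cong (λ B → sym (map-∘ Cs)) Bs)) As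

sub-cong  : ∀ {M N} x S → M ≅ N → sub M x S ≈ sub N x S
subR-cong : ∀ {r s} x S → r ≅ᵣ s → subR r x S ≈ᵦ subR s x S
subB-cong : ∀ {P Q} x S → P ≅ᵦ Q → subB P x S ≈ᵦ subB Q x S
sub-cong x S var       = ≈.↭-refl
sub-cong x S (lam e)   = map⁺ lam (sub-cong (suc x) (map (shift 0) S) e)
sub-cong x S (app e f) = productWith⁺ app app (sub-cong x S e) (subB-cong x S f)
subR-cong x S (lin e)  = map⁺ (λ e' → lin e' ∷ []) (sub-cong x S e)
subR-cong x S (bang e) = ≈ᵦ.prep (bangs-cong (sub-cong x S e)) ≈ᵦ.↭-refl
subB-cong x S []       = ≈ᵦ.↭-refl
subB-cong x S (_∷_ {r} {s} {P} {Q} e p) = begin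
  subB (r ∷ P) x S                                ≡⟨ subB-∷ r P x S ⟩
  productWith _++_ (subR r x S) (subB P x S)      ↭⟨ productWith⁺ _++_ ≅ᵦ-++ (subR-cong x S e) (subB-cong x S p) ⟩
  productWith _++_ (subR s x S) (subB Q x S)      ≡⟨ subB-∷ s Q x S ⟨
  subB (s ∷ Q) x S                                ∎
  where open ≈ᵦ.PermutationReasoning
subB-cong x S (swap {r} {s} {P}) = begin
  subB (r ∷ s ∷ P) x S                                                  ≡⟨ expand r s ⟩
  productWith _++_ (subR r x S) (productWith _++_ (subR s x S) (subB P x S))
    ↭⟨ productWith-++-comm (subR r x S) (subR s x S) (subB P x S) ⟩
  productWith _++_ (subR s x S) (productWith _++_ (subR r x S) (subB P x S)) ≡⟨ expand s r ⟨
  subB (s ∷ r ∷ P) x S                                                  ∎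
  where
  open ≈ᵦ.PermutationReasoning
  expand : ∀ r s → subB (r ∷ s ∷ P) x S ≡ productWith _++_ (subR r x S) (productWith _++_ (subR s x S) (subB P x S))
  expand r s = ≡-trans (subB-∷ r (s ∷ P) x S) (cong (productWith _++_ (subR r x S)) (subB-∷ s P x S))
subB-cong x S (trans p q) = ≈ᵦ.↭-trans (subB-cong x S p) (subB-cong x S q)

sub-resp-≅ : ∀ {M N x S a} → M ≅ N → a ∈ sub M x S → Σ Term (λ b → b ∈ sub N x S × a ≅ b)
sub-resp-≅ {x = x} {S} e a∈ = ∈-resp-↭ a∈ (sub-cong x S e)

-- the bag that replaces the resource r when the linear substitution hits its term
lsubHead : Resource → Term → Bag
lsubHead (lin M) M'  = lin M' ∷ []
lsubHead (bang M) M' = lin M' ∷ bang M ∷ []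

body : Resource → Term
body (lin M)  = M
body (bang M) = M

lsubB-∷ : ∀ r P x N → lsubB (r ∷ P) x N ≡ map (λ M' → lsubHead r M' ++ P) (lsub (body r) x N) ++ map (r ∷_) (lsubB P x N)
lsubB-∷ (lin M) P x N  = refl
lsubB-∷ (bang M) P x N = refl

∈-lsub-var : ∀ z t → t ∈ lsub (var z) z t
∈-lsub-var z t rewrite ≡ᵇ-refl z = here refl

module _ {x : ℕ} {N : Term} where
  lsub-app⁺ˡ : ∀ {M P M'} → M' ∈ lsub M x N → app M' P ∈ lsub (app M P) x N
  lsub-app⁺ˡ {M} {P} M'∈ = ∈-++⁺ˡ (∈-map⁺ (λ M' → app M' P) M'∈)

  lsub-app⁺ʳ : ∀ {M P P'} → P' ∈ lsubB P x N → app M P' ∈ lsub (app M P) x N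
  lsub-app⁺ʳ {M} {P} P'∈ = ∈-++⁺ʳ (map (λ M' → app M' P) (lsub M x N)) (∈-map⁺ (app M) P'∈)

  lsub-app⁻ : ∀ {M P a} → a ∈ lsub (app M P) x N →
    Σ Term (λ M' → M' ∈ lsub M x N × a ≡ app M' P) ⊎ Σ Bag (λ P' → P' ∈ lsubB P x N × a ≡ app M P')
  lsub-app⁻ {M} {P} a∈ with ∈-++⁻ (map (λ M' → app M' P) (lsub M x N)) a∈
  ... | inj₁ a∈ˡ = inj₁ (∈-map⁻ _ a∈ˡ)
  ... | inj₂ a∈ʳ = inj₂ (∈-map⁻ _ a∈ʳ)

  lsubB-∷⁺ʰ : ∀ {r P M'} → M' ∈ lsub (body r) x N → (lsubHead r M' ++ P) ∈ lsubB (r ∷ P) x N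
  lsubB-∷⁺ʰ {r} {P} M'∈ =
    subst ((lsubHead r _ ++ P) ∈_) (sym (lsubB-∷ r P x N)) (∈-++⁺ˡ (∈-map⁺ (λ M' → lsubHead r M' ++ P) M'∈))

  lsubB-lin⁺ʰ : ∀ {M P M'} → M' ∈ lsub M x N → (lin M' ∷ P) ∈ lsubB (lin M ∷ P) x N
  lsubB-lin⁺ʰ = lsubB-∷⁺ʰ {r = lin _}

  lsubB-bang⁺ʰ : ∀ {M P M'} → M' ∈ lsub M x N → (lin M' ∷ bang M ∷ P) ∈ lsubB (bang M ∷ P) x N
  lsubB-bang⁺ʰ = lsubB-∷⁺ʰ {r = bang _}

  lsubB-∷⁺ᵗ : ∀ {r P P'} → P' ∈ lsubB P x N → (r ∷ P') ∈ lsubB (r ∷ P) x N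
  lsubB-∷⁺ᵗ {r} {P} P'∈ =
    subst ((r ∷ _) ∈_) (sym (lsubB-∷ r P x N))
          (∈-++⁺ʳ (map (λ M' → lsubHead r M' ++ P) (lsub (body r) x N)) (∈-map⁺ (r ∷_) P'∈))

  lsubB-∷⁻ : ∀ {r P a} → a ∈ lsubB (r ∷ P) x N →
    Σ Term (λ M' → M' ∈ lsub (body r) x N × a ≡ lsubHead r M' ++ P) ⊎ Σ Bag (λ P' → P' ∈ lsubB P x N × a ≡ r ∷ P')
  lsubB-∷⁻ {r} {P} a∈ with ∈-++⁻ (map (λ M' → lsubHead r M' ++ P) (lsub (body r) x N)) (subst (_ ∈_) (lsubB-∷ r P x N) a∈)
  ... | inj₁ a∈ˡ = inj₁ (∈-map⁻ _ a∈ˡ)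
  ... | inj₂ a∈ʳ = inj₂ (∈-map⁻ _ a∈ʳ)

lsubHead-cong : ∀ {r s M N} → r ≅ᵣ s → M ≅ N → lsubHead r M ≅ᵦ lsubHead s N
lsubHead-cong (lin e) f  = lin f ∷ []
lsubHead-cong (bang e) f = lin f ∷ bang e ∷ []

lsubB-∷-resp-≅ : ∀ {r s P Q x L a} → r ≅ᵣ s → P ≅ᵦ Q →
   (∀ {a} → a ∈ lsub (body r) x L → Σ Term (λ b → b ∈ lsub (body s) x L × a ≅ b)) →
   (∀ {a} → a ∈ lsubB P x L → Σ Bag (λ b → b ∈ lsubB Q x L × a ≅ᵦ b)) →
   a ∈ lsubB (r ∷ P) x L → Σ Bag (λ b → b ∈ lsubB (s ∷ Q) x L × a ≅ᵦ b)
lsubB-∷-resp-≅ {r} {s} {P} {Q} {x} {L} e p body-resp tail-resp a∈ with lsubB-∷⁻ {x} {L} {r} {P} a∈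
... | inj₁ (M' , M'∈ , refl) with body-resp M'∈
...   | b , b∈ , M'≅b = lsubHead s b ++ Q , lsubB-∷⁺ʰ {r = s} b∈ , ≅ᵦ-++ (lsubHead-cong e M'≅b) p
lsubB-∷-resp-≅ e p body-resp tail-resp a∈ | inj₂ (P' , P'∈ , refl) with tail-resp P'∈
...   | b , b∈ , P'≅b = _ ∷ b , lsubB-∷⁺ᵗ b∈ , e ∷ P'≅b

lsub-resp-≅  : ∀ {M N x L a} → M ≅ N → a ∈ lsub M x L → Σ Term (λ b → b ∈ lsub N x L × a ≅ b)
lsubB-resp-≅ : ∀ {P Q x L a} → P ≅ᵦ Q → a ∈ lsubB P x L → Σ Bag (λ b → b ∈ lsubB Q x L × a ≅ᵦ b)
lsub-resp-≅ var a∈ = _ , a∈ , ≅-refl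
lsub-resp-≅ (lam e) a∈ with ∈-map⁻ lam a∈
... | a' , a'∈ , refl with lsub-resp-≅ e a'∈
... | b , b∈ , a'≅b = lam b , ∈-map⁺ lam b∈ , lam a'≅b
lsub-resp-≅ {app M P} {app N Q} {x} {L} (app e f) a∈ with lsub-app⁻ {x} {L} {M} {P} a∈
... | inj₁ (M' , M'∈ , refl) with lsub-resp-≅ e M'∈
...   | b , b∈ , M'≅b = app b Q , lsub-app⁺ˡ b∈ , app M'≅b f
lsub-resp-≅ (app e f) a∈ | inj₂ (P' , P'∈ , refl) with lsubB-resp-≅ f P'∈
...   | b , b∈ , P'≅b = app _ b , lsub-app⁺ʳ b∈ , app e P'≅b
lsubB-resp-≅ [] ()
lsubB-resp-≅ (lin e ∷ p) a∈  = lsubB-∷-resp-≅ (lin e) p (lsub-resp-≅ e) (lsubB-resp-≅ p) a∈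
lsubB-resp-≅ (bang e ∷ p) a∈ = lsubB-∷-resp-≅ (bang e) p (lsub-resp-≅ e) (lsubB-resp-≅ p) a∈
lsubB-resp-≅ {r ∷ s ∷ P} {x = x} {L} swap a∈ with lsubB-∷⁻ {x} {L} {r} {s ∷ P} a∈
... | inj₁ (M' , M'∈ , refl) =
  s ∷ lsubHead r M' ++ P , lsubB-∷⁺ᵗ (lsubB-∷⁺ʰ {r = r} M'∈) , ≅ᵦ-sym (≅ᵦ-shift s (lsubHead r M') P)
... | inj₂ (P' , P'∈ , refl) with lsubB-∷⁻ {x} {L} {s} {P} P'∈
...   | inj₁ (M' , M'∈ , refl) = lsubHead s M' ++ r ∷ P , lsubB-∷⁺ʰ {r = s} M'∈ , ≅ᵦ-shift r (lsubHead s M') P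
...   | inj₂ (P'' , P''∈ , refl) = s ∷ r ∷ P'' , lsubB-∷⁺ᵗ (lsubB-∷⁺ᵗ P''∈) , swap
lsubB-resp-≅ (trans p q) a∈ with lsubB-resp-≅ p a∈
... | b , b∈ , a≅b with lsubB-resp-≅ q b∈
... | c , c∈ , b≅c = c , c∈ , trans a≅b b≅c

lsubR-resp-≅ : ∀ {M N y a} r → M ≅ N → a ∈ lsubR M y r → Σ Term (λ b → b ∈ lsubR N y r × a ≅ b)
lsubR-resp-≅ (lin L) e a∈  = lsub-resp-≅ e a∈
lsubR-resp-≅ (bang L) e a∈ = sub-resp-≅ e a∈

lsubBag-resp-≅ : ∀ {M N y a} B → M ≅ N → a ∈ lsubBag M y B → Σ Term (λ b → b ∈ lsubBag N y B × a ≅ b)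
lsubBag-resp-≅ {N = N} [] e (here refl) = N , here refl , e
lsubBag-resp-≅ {M} {N} {y} (r ∷ B) e a∈ with ∈-concatMap⁻ (λ A → lsubBag A y B) (lsubR M y r) a∈
... | A , A∈ , a∈A with lsubR-resp-≅ r e A∈
... | A' , A'∈ , A≅A' with lsubBag-resp-≅ B A≅A' a∈A
... | b , b∈ , a≅b = b , ∈-concatMap⁺ (λ A → lsubBag A y B) A'∈ b∈ , a≅b

substBag0-resp-≅ : ∀ {M N y a} B → M ≅ N → a ∈ substBag0 M y B → Σ Term (λ b → b ∈ substBag0 N y B × a ≅ b)
substBag0-resp-≅ {M} {N} {y} B e a∈ with ∈-concatMap⁻ (λ A → sub A y []) (lsubBag M y B) a∈
... | A , A∈ , a∈A with lsubBag-resp-≅ B e A∈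
... | A' , A'∈ , A≅A' with sub-resp-≅ A≅A' a∈A
... | b , b∈ , a≅b = b , ∈-concatMap⁺ (λ A → sub A y []) A'∈ b∈ , a≅b

lower-cong  : ∀ {M N} c → M ≅ N → lower c M ≅ lower c N
lowerB-cong : ∀ {P Q} c → P ≅ᵦ Q → lowerB c P ≅ᵦ lowerB c Q
lower-cong c var              = ≅-refl
lower-cong c (lam e)          = lam (lower-cong (suc c) e)
lower-cong c (app e f)        = app (lower-cong c e) (lowerB-cong c f)
lowerB-cong c []              = []
lowerB-cong c (lin e ∷ p)     = lin (lower-cong c e) ∷ lowerB-cong c p
lowerB-cong c (bang e ∷ p)    = bang (lower-cong c e) ∷ lowerB-cong c p
lowerB-cong c swap            = swap
lowerB-cong c (trans p q)     = trans (lowerB-cong c p) (lowerB-cong c q)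

occ-lsub  : ∀ {y x N a} A → occ y A ≡ false → occ y N ≡ false → a ∈ lsub A x N → occ y a ≡ false
occB-lsub : ∀ {y x N a} P → occB y P ≡ false → occ y N ≡ false → a ∈ lsubB P x N → occB y a ≡ false
occ-lsub {y} {x} (var z) y∉A y∉N a∈ with ≡ᵇ-view z x
... | eq _ e rewrite e with a∈
...   | here refl = y∉N
occ-lsub {y} {x} (var z) y∉A y∉N a∈ | ne _ e rewrite e with a∈
... | ()
occ-lsub {y} {x} {N} (lam A) y∉A y∉N a∈ with ∈-map⁻ lam a∈
... | a , a∈' , refl = occ-lsub A y∉A (≡-trans (occ-shift z≤n N) y∉N) a∈'
occ-lsub {y} {x} {N} (app M P) y∉A y∉N a∈ with ∨-false⁻ {occ y M} y∉A | lsub-app⁻ {x} {N} {M} {P} a∈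
... | y∉M , y∉P | inj₁ (M' , M'∈ , refl) rewrite occ-lsub M y∉M y∉N M'∈ = y∉P
... | y∉M , y∉P | inj₂ (P' , P'∈ , refl) rewrite y∉M = occB-lsub P y∉P y∉N P'∈
occB-lsub [] y∉P y∉N ()
occB-lsub {y} {x} {N} (lin M ∷ P) y∉MP y∉N a∈ with ∨-false⁻ {occ y M} y∉MP | lsubB-∷⁻ {x} {N} {lin M} {P} a∈
... | y∉M , y∉P | inj₁ (M' , M'∈ , refl) rewrite occ-lsub M y∉M y∉N M'∈ = y∉P
... | y∉M , y∉P | inj₂ (P' , P'∈ , refl) rewrite y∉M = occB-lsub P y∉P y∉N P'∈
occB-lsub {y} {x} {N} (bang M ∷ P) y∉MP y∉N a∈ with ∨-false⁻ {occ y M} y∉MP | lsubB-∷⁻ {x} {N} {bang M} {P} a∈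
... | y∉M , y∉P | inj₁ (M' , M'∈ , refl) rewrite occ-lsub M y∉M y∉N M'∈ | y∉M = y∉P
... | y∉M , y∉P | inj₂ (P' , P'∈ , refl) rewrite y∉M = occB-lsub P y∉P y∉N P'∈

-- Composing two substitutions

subs : Sum → ℕ → Sum → Sum
subs A x S = concatMap (λ a → sub a x S) A

subsB : SumB → ℕ → Sum → SumB
subsB A x S = concatMap (λ a → subB a x S) A

subs-shift : ∀ y S T → subs (map (shift 0) S) (suc y) (map (shift 0) T) ≡ map (shift 0) (subs S y T)
subs-shift y S T =
  ≡-trans (concatMap-map _ (shift 0) S)
          (≡-trans (concatMap-cong (λ s → sub-shift z≤n s T) S) (sym (map-concatMap (shift 0) (λ s → sub s y T) S)))

subs-lam : ∀ y X T → subs (map lam X) y T ≡ map lam (subs X (suc y) (map (shift 0) T))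
subs-lam y X T = ≡-trans (concatMap-map _ lam X) (sym (map-concatMap lam (λ a → sub a (suc y) (map (shift 0) T)) X))

subs-app : ∀ X Y y T → subs (productWith app X Y) y T ≈ productWith app (subs X y T) (subsB Y y T)
subs-app X Y y T = ↭ₚ⇒↭ (productWith-concatMap-↭ app _ _ _ (λ _ _ → refl) X Y)

subsB-lin : ∀ X Y y T →
  subsB (productWith lin∷ X Y) y T ≈ᵦ productWith lin∷ (subs X y T) (subsB Y y T)
subsB-lin X Y y T = ↭ₚ⇒↭ (productWith-concatMap-↭ lin∷ _ _ _ (λ _ _ → refl) X Y)

subB-bangs : ∀ Xs P y T → subB (map bang Xs ++ P) y T ≡ map (λ P' → map bang (subs Xs y T) ++ P') (subB P y T)
subB-bangs [] P y T = sym (map-id (subB P y T))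
subB-bangs (X ∷ Xs) P y T rewrite subB-bangs Xs P y T =
  ≡-trans (sym (map-∘ (subB P y T)))
          (map-cong (λ P' → ≡-trans (sym (++-assoc (map bang (sub X y T)) _ P'))
                                    (cong (_++ P') (sym (map-++ bang (sub X y T) (subs Xs y T))))) (subB P y T))

subsB-bang : ∀ R P y S y' T →
  subsB (subB (bang R ∷ P) y S) y' T ≡ map (λ P' → map bang (subs (sub R y S) y' T) ++ P') (subsB (subB P y S) y' T)
subsB-bang R P y S y' T =
  ≡-trans (concatMap-map (λ a → subB a y' T) _ (subB P y S))
          (≡-trans (concatMap-cong (λ P' → subB-bangs (sub R y S) P' y' T) (subB P y S))
                   (sym (map-concatMap _ (λ a → subB a y' T) (subB P y S))))

bangs-prefix-cong : ∀ {X X' Y Y'} → X ≈ X' → Y ≈ᵦ Y' →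
  map (λ P → map bang X ++ P) Y ≈ᵦ map (λ P → map bang X' ++ P) Y'
bangs-prefix-cong {X} {X'} {Y} e f =
  ≈ᵦ.↭-trans (map-pointwise (λ P → ≅ᵦ-++ (bangs-cong e) ≅ᵦ-refl) Y) (map⁺ (≅ᵦ-++ˡ (map bang X')) f)

sub-sub   : ∀ A y S T → subs (sub A y S) y T ≈ sub A y (subs S y T)
subB-subB : ∀ P y S T → subsB (subB P y S) y T ≈ᵦ subB P y (subs S y T)
sub-sub (var z) y S T with ≡ᵇ-view z y
... | eq _ e rewrite e     = ≈.↭-refl
... | ne _ e rewrite e | e = ≈.↭-refl
sub-sub (lam A) y S T rewrite subs-lam y (sub A (suc y) (map (shift 0) S)) T =
  map⁺ lam (≈.↭-trans (sub-sub A (suc y) (map (shift 0) S) (map (shift 0) T))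
                      (≈.↭-reflexive (cong (sub A (suc y)) (subs-shift y S T))))
sub-sub (app M P) y S T =
  ≈.↭-trans (subs-app (sub M y S) (subB P y S) y T) (productWith⁺ app app (sub-sub M y S T) (subB-subB P y S T))
subB-subB [] y S T = ≈ᵦ.↭-refl
subB-subB (lin M ∷ P) y S T =
  ≈ᵦ.↭-trans (subsB-lin (sub M y S) (subB P y S) y T)
             (productWith⁺ lin∷ (λ e f → lin e ∷ f) (sub-sub M y S T) (subB-subB P y S T))
subB-subB (bang M ∷ P) y S T rewrite subsB-bang M P y S y T = bangs-prefix-cong (sub-sub M y S T) (subB-subB P y S T)

subs-fresh : ∀ {y T} S → (∀ {s} → s ∈ S → occ y s ≡ false) → subs S y T ≡ S
subs-fresh [] fresh = refl
subs-fresh {y} {T} (s ∷ S) fresh rewrite sub-fresh {y} s T (fresh (here refl)) =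
  cong (s ∷_) (subs-fresh S (λ s∈ → fresh (there s∈)))

sub-sub-comm   : ∀ {x y} → x ≢ y → ∀ A S T → (∀ {s} → s ∈ S → occ y s ≡ false) →
                 subs (sub A y T) x S ≈ subs (sub A x S) y (subs T x S)
subB-subB-comm : ∀ {x y} → x ≢ y → ∀ P S T → (∀ {s} → s ∈ S → occ y s ≡ false) →
                 subsB (subB P y T) x S ≈ᵦ subsB (subB P x S) y (subs T x S)
sub-sub-comm {x} {y} x≢y (var z) S T fresh with ≡ᵇ-view z y | ≡ᵇ-view z x
... | eq refl _ | eq refl _ = ⊥-elim (x≢y refl)
... | eq refl e | ne _ e' rewrite e | e' | e = ≈.↭-reflexive (sym (++-identityʳ (subs T x S)))
... | ne _ e | eq refl e' rewrite e | e' = ≈.↭-reflexive (≡-trans (++-identityʳ S) (sym (subs-fresh S fresh)))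
... | ne _ e | ne _ e' rewrite e | e' | e = ≈.↭-refl
sub-sub-comm {x} {y} x≢y (lam A) S T fresh
  rewrite subs-lam x (sub A (suc y) (map (shift 0) T)) S | subs-lam y (sub A (suc x) (map (shift 0) S)) (subs T x S) =
  map⁺ lam (≈.↭-trans (sub-sub-comm (λ q → x≢y (cong pred q)) A (map (shift 0) S) (map (shift 0) T) (shift₀-fresh S fresh))
                      (≈.↭-reflexive (cong (subs (sub A (suc x) (map (shift 0) S)) (suc y)) (subs-shift x T S))))
sub-sub-comm {x} {y} x≢y (app M P) S T fresh = begin
  subs (sub (app M P) y T) x S                                            ↭⟨ subs-app (sub M y T) (subB P y T) x S ⟩
  productWith app (subs (sub M y T) x S) (subsB (subB P y T) x S)
    ↭⟨ productWith⁺ app app (sub-sub-comm x≢y M S T fresh) (subB-subB-comm x≢y P S T fresh) ⟩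
  productWith app (subs (sub M x S) y (subs T x S)) (subsB (subB P x S) y (subs T x S))
    ↭⟨ subs-app (sub M x S) (subB P x S) y (subs T x S) ⟨
  subs (sub (app M P) x S) y (subs T x S)                                 ∎
  where open ≈.PermutationReasoning
subB-subB-comm x≢y [] S T fresh = ≈ᵦ.↭-refl
subB-subB-comm {x} {y} x≢y (lin M ∷ P) S T fresh = begin
  subsB (subB (lin M ∷ P) y T) x S                          ↭⟨ subsB-lin (sub M y T) (subB P y T) x S ⟩
  productWith lin∷ (subs (sub M y T) x S) (subsB (subB P y T) x S)
    ↭⟨ productWith⁺ lin∷ (λ e f → lin e ∷ f) (sub-sub-comm x≢y M S T fresh) (subB-subB-comm x≢y P S T fresh) ⟩
  productWith lin∷ (subs (sub M x S) y (subs T x S)) (subsB (subB P x S) y (subs T x S))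
    ↭⟨ subsB-lin (sub M x S) (subB P x S) y (subs T x S) ⟨
  subsB (subB (lin M ∷ P) x S) y (subs T x S)               ∎
  where open ≈ᵦ.PermutationReasoning
subB-subB-comm {x} {y} x≢y (bang M ∷ P) S T fresh
  rewrite subsB-bang M P y T x S | subsB-bang M P x S y (subs T x S) =
  bangs-prefix-cong (sub-sub-comm x≢y M S T fresh) (subB-subB-comm x≢y P S T fresh)

-- Linear substitution past other substitutions

lsubs : Sum → ℕ → Term → Sum
lsubs A x N = concatMap (λ a → lsub a x N) A

lsubsB : SumB → ℕ → Term → SumB
lsubsB A x N = concatMap (λ a → lsubB a x N) A

lsubs-lam : ∀ X x N → lsubs (map lam X) x N ≡ map lam (lsubs X (suc x) (shift 0 N))
lsubs-lam X x N = ≡-trans (concatMap-map _ lam X) (sym (map-concatMap lam (λ a → lsub a (suc x) (shift 0 N)) X))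

lsubs-shift : ∀ T x N → lsubs (map (shift 0) T) (suc x) (shift 0 N) ≡ map (shift 0) (lsubs T x N)
lsubs-shift T x N =
  ≡-trans (concatMap-map _ (shift 0) T)
          (≡-trans (concatMap-cong (λ s → lsub-shift z≤n s N) T) (sym (map-concatMap (shift 0) (λ s → lsub s x N) T)))

lsubB-bangs⁻ : ∀ Rs P {x N a} → a ∈ lsubB (map bang Rs ++ P) x N →
  Σ Term (λ R → R ∈ Rs × Σ Term (λ R' → R' ∈ lsub R x N × a ≅ᵦ (lin R' ∷ map bang Rs ++ P)))
  ⊎ Σ Bag (λ P' → P' ∈ lsubB P x N × a ≡ map bang Rs ++ P')
lsubB-bangs⁻ [] P a∈ = inj₂ (_ , a∈ , refl)
lsubB-bangs⁻ (R ∷ Rs) P {x} {N} a∈ with lsubB-∷⁻ {x} {N} {bang R} {map bang Rs ++ P} a∈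
... | inj₁ (R' , R'∈ , refl) = inj₁ (R , here refl , R' , R'∈ , ≅ᵦ-refl)
... | inj₂ (a' , a'∈ , refl) with lsubB-bangs⁻ Rs P a'∈
...   | inj₁ (R₀ , R₀∈ , R' , R'∈ , e) = inj₁ (R₀ , there R₀∈ , R' , R'∈ , trans (≅ᵣ-refl ∷ e) swap)
...   | inj₂ (P' , P'∈ , refl)         = inj₂ (P' , P'∈ , refl)

lsubB-bangs⁺ʰ : ∀ Rs P {x N R R'} → R ∈ Rs → R' ∈ lsub R x N →
  Σ Bag (λ Z → Z ∈ lsubB (map bang Rs ++ P) x N × Z ≅ᵦ (lin R' ∷ map bang Rs ++ P))
lsubB-bangs⁺ʰ (R ∷ Rs) P (here refl) R'∈ = _ , lsubB-bang⁺ʰ R'∈ , ≅ᵦ-refl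
lsubB-bangs⁺ʰ (R₀ ∷ Rs) P (there R∈) R'∈ with lsubB-bangs⁺ʰ Rs P R∈ R'∈
... | Z , Z∈ , e = bang R₀ ∷ Z , lsubB-∷⁺ᵗ Z∈ , trans (≅ᵣ-refl ∷ e) swap

lsubB-bangs⁺ᵗ : ∀ Rs P {x N P'} → P' ∈ lsubB P x N → (map bang Rs ++ P') ∈ lsubB (map bang Rs ++ P) x N
lsubB-bangs⁺ᵗ [] P P'∈       = P'∈
lsubB-bangs⁺ᵗ (R ∷ Rs) P P'∈ = lsubB-∷⁺ᵗ (lsubB-bangs⁺ᵗ Rs P P'∈)

-- where the linear substitution of N for x in A{T/y} landed: in A itself, or in a copy t of T
data Hit {X : Set} (lsubX : X → ℕ → Term → List X) (x y : ℕ) (T : Sum) (N : Term) (A v : X) : Set where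
  in-A : v ∈ lsubX A x N → Hit lsubX x y T N A v
  in-T : ∀ {t} → t ∈ lsubs T x N → v ∈ lsubX A y t → Hit lsubX x y T N A v

hit-map : ∀ {X X' : Set} {lsubX : X → ℕ → Term → List X} {lsubX' : X' → ℕ → Term → List X'} {x y T N A v A' v'} →
  (∀ {z K} → v ∈ lsubX A z K → v' ∈ lsubX' A' z K) → Hit lsubX x y T N A v → Hit lsubX' x y T N A' v'
hit-map f (in-A v∈)     = in-A (f v∈)
hit-map f (in-T t∈ v∈)  = in-T t∈ (f v∈)

-- Chain rule: (A{T/y})⟨N/x⟩ ⊆ A⟨N/x⟩{T/y} + A⟨T⟨N/x⟩/y⟩{T/y}, up to _≅_.
LsubSub : Term → ℕ → Sum → ℕ → Term → Term → Set
LsubSub A y T x N a = Σ Term (λ v → Hit lsub x y T N A v × Σ Term (λ l → l ∈ sub v y T × l ≅ a))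

LsubSubᵦ : Bag → ℕ → Sum → ℕ → Term → Bag → Set
LsubSubᵦ P y T x N a = Σ Bag (λ v → Hit lsubB x y T N P v × Σ Bag (λ l → l ∈ subB v y T × l ≅ᵦ a))

lsub-sub⁻   : ∀ {x y} → x ≢ y → ∀ A T N → occ y N ≡ false → (∀ {t} → t ∈ lsubs T x N → occ y t ≡ false) →
              ∀ {a} → a ∈ lsubs (sub A y T) x N → LsubSub A y T x N a
lsubB-subB⁻ : ∀ {x y} → x ≢ y → ∀ P T N → occ y N ≡ false → (∀ {t} → t ∈ lsubs T x N → occ y t ≡ false) →
              ∀ {a} → a ∈ lsubsB (subB P y T) x N → LsubSubᵦ P y T x N a
lsub-sub⁻ {x} {y} x≢y (var z) T N y∉N y∉T' {a} a∈ with ≡ᵇ-view z y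
... | eq refl e rewrite e =
  a , in-T a∈ (∈-lsub-var z a) , a , subst (a ∈_) (sym (sub-fresh a T (y∉T' a∈))) (here refl) , ≅-refl
... | ne _ e rewrite e with ≡ᵇ-view z x
...   | ne _ e' rewrite e' with a∈
...     | ()
lsub-sub⁻ {x} {y} x≢y (var z) T N y∉N y∉T' a∈ | ne _ e | eq refl e' rewrite e' with a∈
... | here refl = N , in-A (∈-lsub-var z N) , N , subst (N ∈_) (sym (sub-fresh N T y∉N)) (here refl) , ≅-refl
lsub-sub⁻ {x} {y} x≢y (lam A) T N y∉N y∉T' a∈ rewrite lsubs-lam (sub A (suc y) (map (shift 0) T)) x N
  with ∈-map⁻ lam a∈
... | a , a∈' , refl
  with lsub-sub⁻ (λ q → x≢y (cong pred q)) A (map (shift 0) T) (shift 0 N) (≡-trans (occ-shift z≤n N) y∉N) y∉T'' a∈'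
  where
  y∉T'' : ∀ {t} → t ∈ lsubs (map (shift 0) T) (suc x) (shift 0 N) → occ (suc y) t ≡ false
  y∉T'' t∈ rewrite lsubs-shift T x N = shift₀-fresh (lsubs T x N) y∉T' t∈
... | v , hit , l , l∈ , l≅a = lam v , hit-map⁺ hit , lam l , ∈-map⁺ lam l∈ , lam l≅a
  where
  hit-map⁺ : Hit lsub (suc x) (suc y) (map (shift 0) T) (shift 0 N) A v → Hit lsub x y T N (lam A) (lam v)
  hit-map⁺ (in-A v∈)    = in-A (∈-map⁺ lam v∈)
  hit-map⁺ (in-T {t} t∈ v∈) with ∈-map⁻ (shift 0) (subst (t ∈_) (lsubs-shift T x N) t∈)
  ... | t' , t'∈ , refl = in-T t'∈ (∈-map⁺ lam v∈)
lsub-sub⁻ {x} {y} x≢y (app M P) T N y∉N y∉T' a∈ with ∈-concatMap⁻ (λ c → lsub c x N) _ a∈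
... | c , c∈ , a∈c with ∈-productWith⁻ app (sub M y T) (subB P y T) c∈
... | M₀ , M₀∈ , P₀ , P₀∈ , refl with lsub-app⁻ {x} {N} {M₀} {P₀} a∈c
...   | inj₁ (M' , M'∈ , refl) with lsub-sub⁻ x≢y M T N y∉N y∉T' (∈-concatMap⁺ (λ c → lsub c x N) M₀∈ M'∈)
...     | v , hit , l , l∈ , l≅ = app v P , hit-map lsub-app⁺ˡ hit , app l P₀ , ∈-productWith⁺ app l∈ P₀∈ , app l≅ ≅ᵦ-refl
lsub-sub⁻ {x} {y} x≢y (app M P) T N y∉N y∉T' a∈ | c , c∈ , a∈c | M₀ , M₀∈ , P₀ , P₀∈ , refl | inj₂ (P' , P'∈ , refl)
  with lsubB-subB⁻ x≢y P T N y∉N y∉T' (∈-concatMap⁺ (λ c → lsubB c x N) P₀∈ P'∈)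
... | v , hit , l , l∈ , l≅ = app M v , hit-map lsub-app⁺ʳ hit , app M₀ l , ∈-productWith⁺ app M₀∈ l∈ , app ≅-refl l≅
lsubB-subB⁻ x≢y [] T N y∉N y∉T' ()
lsubB-subB⁻ {x} {y} x≢y (lin M ∷ P) T N y∉N y∉T' a∈ with ∈-concatMap⁻ (λ c → lsubB c x N) _ a∈
... | c , c∈ , a∈c with ∈-productWith⁻ lin∷ (sub M y T) (subB P y T) c∈
... | M₀ , M₀∈ , P₀ , P₀∈ , refl with lsubB-∷⁻ {x} {N} {lin M₀} {P₀} a∈c
...   | inj₁ (M' , M'∈ , refl) with lsub-sub⁻ x≢y M T N y∉N y∉T' (∈-concatMap⁺ (λ c → lsub c x N) M₀∈ M'∈)
...     | v , hit , l , l∈ , l≅ =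
          lin v ∷ P , hit-map lsubB-lin⁺ʰ hit , lin l ∷ P₀ , ∈-productWith⁺ lin∷ l∈ P₀∈ , lin l≅ ∷ ≅ᵦ-refl
lsubB-subB⁻ {x} {y} x≢y (lin M ∷ P) T N y∉N y∉T' a∈ | c , c∈ , a∈c | M₀ , M₀∈ , P₀ , P₀∈ , refl | inj₂ (P' , P'∈ , refl)
  with lsubB-subB⁻ x≢y P T N y∉N y∉T' (∈-concatMap⁺ (λ c → lsubB c x N) P₀∈ P'∈)
... | v , hit , l , l∈ , l≅ =
      lin M ∷ v , hit-map lsubB-∷⁺ᵗ hit , lin M₀ ∷ l , ∈-productWith⁺ lin∷ M₀∈ l∈ , ≅ᵣ-refl ∷ l≅
lsubB-subB⁻ {x} {y} x≢y (bang R ∷ P) T N y∉N y∉T' a∈ with ∈-concatMap⁻ (λ c → lsubB c x N) _ a∈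
... | c , c∈ , a∈c with ∈-map⁻ (λ P' → map bang (sub R y T) ++ P') c∈
... | P₀ , P₀∈ , refl with lsubB-bangs⁻ (sub R y T) P₀ a∈c
...   | inj₁ (R₀ , R₀∈ , R' , R'∈ , a≅) with lsub-sub⁻ x≢y R T N y∉N y∉T' (∈-concatMap⁺ (λ c → lsub c x N) R₀∈ R'∈)
...     | v , hit , l , l∈ , l≅ =
          lin v ∷ bang R ∷ P , hit-map lsubB-bang⁺ʰ hit , lin l ∷ map bang (sub R y T) ++ P₀
          , ∈-productWith⁺ lin∷ l∈ c∈ , trans (lin l≅ ∷ ≅ᵦ-refl) (≅ᵦ-sym a≅)
lsubB-subB⁻ {x} {y} x≢y (bang R ∷ P) T N y∉N y∉T' a∈ | c , c∈ , a∈c | P₀ , P₀∈ , refl | inj₂ (P' , P'∈ , refl)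
  with lsubB-subB⁻ x≢y P T N y∉N y∉T' (∈-concatMap⁺ (λ c → lsubB c x N) P₀∈ P'∈)
... | v , hit , l , l∈ , l≅ =
      bang R ∷ v , hit-map lsubB-∷⁺ᵗ hit , map bang (sub R y T) ++ l , ∈-map⁺ (λ P' → map bang (sub R y T) ++ P') l∈
      , ≅ᵦ-++ˡ _ l≅

-- where the linear substitution of N for x in M⟨p/y⟩ landed: in M, or in the substituted copy of p
data ChainHit {X : Set} (lsubX : X → ℕ → Term → List X) (y : ℕ) (p : Term) (x : ℕ) (N : Term) (M A : X) : Set where
  in-M : ∀ {M'} → M' ∈ lsubX M x N → A ∈ lsubX M' y p → ChainHit lsubX y p x N M A
  in-p : ∀ {p'} → p' ∈ lsub p x N → A ∈ lsubX M y p' → ChainHit lsubX y p x N M A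

chainHit-map : ∀ {X X' : Set} {lsubX : X → ℕ → Term → List X} {lsubX' : X' → ℕ → Term → List X'}
  {y p x N M M° A} (C : X → X') →
  (∀ {M' z K} → M' ∈ lsubX M z K → C M' ∈ lsubX' M° z K) →
  (∀ {M' A z K} → A ∈ lsubX M' z K → C A ∈ lsubX' (C M') z K) →
  ChainHit lsubX y p x N M A → ChainHit lsubX' y p x N M° (C A)
chainHit-map C f g (in-M M'∈ A∈) = in-M (f M'∈) (g A∈)
chainHit-map C f g (in-p p'∈ A∈) = in-p p'∈ (f A∈)

-- Leibniz rule: M⟨p/y⟩⟨N/x⟩ ⊆ M⟨N/x⟩⟨p/y⟩ + M⟨p⟨N/x⟩/y⟩, up to _≅_.
LsubLsub : Term → ℕ → Term → ℕ → Term → Term → Set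
LsubLsub M y p x N A = Σ Term (λ A' → ChainHit lsub y p x N M A' × A' ≅ A)

LsubLsubᵦ : Bag → ℕ → Term → ℕ → Term → Bag → Set
LsubLsubᵦ P y p x N A = Σ Bag (λ A' → ChainHit lsubB y p x N P A' × A' ≅ᵦ A)

lsub-lsub⁻   : ∀ M {y p x N A} → A ∈ lsubs (lsub M y p) x N → LsubLsub M y p x N A
lsubB-lsubB⁻ : ∀ P {y p x N A} → A ∈ lsubsB (lsubB P y p) x N → LsubLsubᵦ P y p x N A
lsub-lsub⁻ (var z) {y} {p} {x} {N} {A} A∈ with ≡ᵇ-view z y
... | eq refl e rewrite e with ∈-++⁻ (lsub p x N) A∈
...   | inj₁ A∈' = A , in-p A∈' (∈-lsub-var z A) , ≅-refl
...   | inj₂ ()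
lsub-lsub⁻ (var z) {y} A∈ | ne _ e rewrite e with A∈
... | ()
lsub-lsub⁻ (lam M) {y} {p} {x} {N} A∈ rewrite lsubs-lam (lsub M (suc y) (shift 0 p)) x N with ∈-map⁻ lam A∈
... | A , A∈' , refl with lsub-lsub⁻ M A∈'
...   | A' , in-M M'∈ A'∈ , A'≅ = lam A' , in-M (∈-map⁺ lam M'∈) (∈-map⁺ lam A'∈) , lam A'≅
...   | A' , in-p {p''} p''∈ A'∈ , A'≅ with ∈-map⁻ (shift 0) (subst (p'' ∈_) (lsub-shift z≤n p N) p''∈)
...     | p' , p'∈ , refl = lam A' , in-p p'∈ (∈-map⁺ lam A'∈) , lam A'≅
lsub-lsub⁻ (app M P) {y} {p} {x} {N} A∈ with ∈-concatMap⁻ (λ c → lsub c x N) (lsub (app M P) y p) A∈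
... | c , c∈ , A∈c with lsub-app⁻ {y} {p} {M} {P} c∈
... | inj₁ (M₀ , M₀∈ , refl) with lsub-app⁻ {x} {N} {M₀} {P} A∈c
...   | inj₁ (M' , M'∈ , refl) with lsub-lsub⁻ M (∈-concatMap⁺ (λ c → lsub c x N) M₀∈ M'∈)
...     | A' , hit , A'≅ = app A' P , chainHit-map (λ M → app M P) lsub-app⁺ˡ lsub-app⁺ˡ hit , app A'≅ ≅ᵦ-refl
lsub-lsub⁻ (app M P) A∈ | c , c∈ , A∈c | inj₁ (M₀ , M₀∈ , refl) | inj₂ (P' , P'∈ , refl) =
  app M₀ P' , in-M {M' = app M P'} (lsub-app⁺ʳ P'∈) (lsub-app⁺ˡ M₀∈) , ≅-refl
lsub-lsub⁻ (app M P) {y} {p} {x} {N} A∈ | c , c∈ , A∈c | inj₂ (P₀ , P₀∈ , refl) with lsub-app⁻ {x} {N} {M} {P₀} A∈c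
...   | inj₁ (M' , M'∈ , refl) = app M' P₀ , in-M {M' = app M' P} (lsub-app⁺ˡ M'∈) (lsub-app⁺ʳ P₀∈) , ≅-refl
...   | inj₂ (P' , P'∈ , refl) with lsubB-lsubB⁻ P (∈-concatMap⁺ (λ c → lsubB c x N) P₀∈ P'∈)
...     | A' , hit , A'≅ = app M A' , chainHit-map (app M) lsub-app⁺ʳ lsub-app⁺ʳ hit , app ≅-refl A'≅
lsubB-lsubB⁻ [] ()
lsubB-lsubB⁻ (lin R ∷ P) {y} {p} {x} {N} A∈ with ∈-concatMap⁻ (λ c → lsubB c x N) (lsubB (lin R ∷ P) y p) A∈
... | c , c∈ , A∈c with lsubB-∷⁻ {y} {p} {lin R} {P} c∈
... | inj₁ (R₀ , R₀∈ , refl) with lsubB-∷⁻ {x} {N} {lin R₀} {P} A∈c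
...   | inj₁ (R' , R'∈ , refl) with lsub-lsub⁻ R (∈-concatMap⁺ (λ c → lsub c x N) R₀∈ R'∈)
...     | A' , hit , A'≅ = lin A' ∷ P , chainHit-map (λ M → lin M ∷ P) lsubB-lin⁺ʰ lsubB-lin⁺ʰ hit , lin A'≅ ∷ ≅ᵦ-refl
lsubB-lsubB⁻ (lin R ∷ P) A∈ | c , c∈ , A∈c | inj₁ (R₀ , R₀∈ , refl) | inj₂ (P' , P'∈ , refl) =
  lin R₀ ∷ P' , in-M {M' = lin R ∷ P'} (lsubB-∷⁺ᵗ P'∈) (lsubB-lin⁺ʰ R₀∈) , ≅ᵦ-refl
lsubB-lsubB⁻ (lin R ∷ P) {y} {p} {x} {N} A∈ | c , c∈ , A∈c | inj₂ (P₀ , P₀∈ , refl) with lsubB-∷⁻ {x} {N} {lin R} {P₀} A∈c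
...   | inj₁ (R' , R'∈ , refl) = lin R' ∷ P₀ , in-M {M' = lin R' ∷ P} (lsubB-lin⁺ʰ R'∈) (lsubB-∷⁺ᵗ P₀∈) , ≅ᵦ-refl
...   | inj₂ (P' , P'∈ , refl) with lsubB-lsubB⁻ P (∈-concatMap⁺ (λ c → lsubB c x N) P₀∈ P'∈)
...     | A' , hit , A'≅ = lin R ∷ A' , chainHit-map (lin R ∷_) lsubB-∷⁺ᵗ lsubB-∷⁺ᵗ hit , ≅ᵣ-refl ∷ A'≅
lsubB-lsubB⁻ (bang R ∷ P) {y} {p} {x} {N} A∈ with ∈-concatMap⁻ (λ c → lsubB c x N) (lsubB (bang R ∷ P) y p) A∈
... | c , c∈ , A∈c with lsubB-∷⁻ {y} {p} {bang R} {P} c∈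
... | inj₁ (R₀ , R₀∈ , refl) with lsubB-∷⁻ {x} {N} {lin R₀} {bang R ∷ P} A∈c
...   | inj₁ (R' , R'∈ , refl) with lsub-lsub⁻ R (∈-concatMap⁺ (λ c → lsub c x N) R₀∈ R'∈)
...     | A' , hit , A'≅ =
          lin A' ∷ bang R ∷ P , chainHit-map (λ M → lin M ∷ bang R ∷ P) lsubB-bang⁺ʰ lsubB-lin⁺ʰ hit , lin A'≅ ∷ ≅ᵦ-refl
lsubB-lsubB⁻ (bang R ∷ P) {y} {p} {x} {N} A∈ | c , c∈ , A∈c | inj₁ (R₀ , R₀∈ , refl) | inj₂ (P' , P'∈ , refl)
  with lsubB-∷⁻ {x} {N} {bang R} {P} P'∈
...   | inj₁ (R' , R'∈ , refl) =
        lin R' ∷ lin R₀ ∷ bang R ∷ P , in-M {M' = lin R' ∷ bang R ∷ P} (lsubB-bang⁺ʰ R'∈) (lsubB-∷⁺ᵗ (lsubB-bang⁺ʰ R₀∈)) , swap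
...   | inj₂ (P'' , P''∈ , refl) = lin R₀ ∷ bang R ∷ P'' , in-M {M' = bang R ∷ P''} (lsubB-∷⁺ᵗ P''∈) (lsubB-bang⁺ʰ R₀∈) , ≅ᵦ-refl
lsubB-lsubB⁻ (bang R ∷ P) {y} {p} {x} {N} A∈ | c , c∈ , A∈c | inj₂ (P₀ , P₀∈ , refl) with lsubB-∷⁻ {x} {N} {bang R} {P₀} A∈c
...   | inj₁ (R' , R'∈ , refl) =
        lin R' ∷ bang R ∷ P₀ , in-M {M' = lin R' ∷ bang R ∷ P} (lsubB-bang⁺ʰ R'∈) (lsubB-∷⁺ᵗ (lsubB-∷⁺ᵗ P₀∈)) , ≅ᵦ-refl
...   | inj₂ (P' , P'∈ , refl) with lsubB-lsubB⁻ P (∈-concatMap⁺ (λ c → lsubB c x N) P₀∈ P'∈)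
...     | A' , hit , A'≅ = bang R ∷ A' , chainHit-map (bang R ∷_) lsubB-∷⁺ᵗ lsubB-∷⁺ᵗ hit , ≅ᵣ-refl ∷ A'≅

SubLsub : Term → ℕ → Term → ℕ → Sum → Term → Set
SubLsub M y p x S A =
  Σ Term (λ M' → M' ∈ sub M x S × Σ Term (λ p' → p' ∈ sub p x S × Σ Term (λ A' → A' ∈ lsub M' y p' × A' ≅ A)))

SubLsubᵦ : Bag → ℕ → Term → ℕ → Sum → Bag → Set
SubLsubᵦ P y p x S A =
  Σ Bag (λ P' → P' ∈ subB P x S × Σ Term (λ p' → p' ∈ sub p x S × Σ Bag (λ A' → A' ∈ lsubB P' y p' × A' ≅ᵦ A)))

sub-lsub⁻   : ∀ {x y} → x ≢ y → ∀ M {p S A} → A ∈ subs (lsub M y p) x S → SubLsub M y p x S A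
subB-lsubB⁻ : ∀ {x y} → x ≢ y → ∀ P {p S A} → A ∈ subsB (lsubB P y p) x S → SubLsubᵦ P y p x S A
sub-lsub⁻ {x} {y} x≢y (var z) {p} {S} {A} A∈ with ≡ᵇ-view z y
... | eq refl e rewrite e with ∈-++⁻ (sub p x S) A∈
...   | inj₁ A∈' =
        var z , subst (var z ∈_) (sym (sub-var-≢ S (λ z≡x → x≢y (sym z≡x)))) (here refl) , A , A∈' , A , ∈-lsub-var z A , ≅-refl
...   | inj₂ ()
sub-lsub⁻ x≢y (var z) {p} A∈ | ne _ e rewrite e with A∈
... | ()
sub-lsub⁻ {x} {y} x≢y (lam M) {p} {S} {A} A∈ with ∈-map⁻ lam (subst (A ∈_) (subs-lam x (lsub M (suc y) (shift 0 p)) S) A∈)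
... | A₀ , A₀∈ , refl with sub-lsub⁻ (λ q → x≢y (cong pred q)) M A₀∈
... | M' , M'∈ , p'' , p''∈ , A' , A'∈ , A'≅ with ∈-map⁻ (shift 0) (subst (p'' ∈_) (sub-shift z≤n p S) p''∈)
... | p' , p'∈ , refl = lam M' , ∈-map⁺ lam M'∈ , p' , p'∈ , lam A' , ∈-map⁺ lam A'∈ , lam A'≅
sub-lsub⁻ {x} {y} x≢y (app M P) {p} {S} A∈ with ∈-concatMap⁻ (λ c → sub c x S) (lsub (app M P) y p) A∈
... | c , c∈ , A∈c with lsub-app⁻ {y} {p} {M} {P} c∈
... | inj₁ (M₀ , M₀∈ , refl) with ∈-productWith⁻ app (sub M₀ x S) (subB P x S) A∈c
...   | M₁ , M₁∈ , P₁ , P₁∈ , refl with sub-lsub⁻ x≢y M (∈-concatMap⁺ (λ c → sub c x S) M₀∈ M₁∈)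
...     | M' , M'∈ , p' , p'∈ , A' , A'∈ , A'≅ =
          app M' P₁ , ∈-productWith⁺ app M'∈ P₁∈ , p' , p'∈ , app A' P₁ , lsub-app⁺ˡ A'∈ , app A'≅ ≅ᵦ-refl
sub-lsub⁻ {x} {y} x≢y (app M P) {p} {S} A∈ | c , c∈ , A∈c | inj₂ (P₀ , P₀∈ , refl)
  with ∈-productWith⁻ app (sub M x S) (subB P₀ x S) A∈c
...   | M₁ , M₁∈ , P₁ , P₁∈ , refl with subB-lsubB⁻ x≢y P (∈-concatMap⁺ (λ c → subB c x S) P₀∈ P₁∈)
...     | P' , P'∈ , p' , p'∈ , A' , A'∈ , A'≅ =
          app M₁ P' , ∈-productWith⁺ app M₁∈ P'∈ , p' , p'∈ , app M₁ A' , lsub-app⁺ʳ A'∈ , app ≅-refl A'≅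
subB-lsubB⁻ x≢y [] ()
subB-lsubB⁻ {x} {y} x≢y (lin M ∷ P) {p} {S} A∈ with ∈-concatMap⁻ (λ c → subB c x S) (lsubB (lin M ∷ P) y p) A∈
... | c , c∈ , A∈c with lsubB-∷⁻ {y} {p} {lin M} {P} c∈
... | inj₁ (M₀ , M₀∈ , refl) with ∈-productWith⁻ lin∷ (sub M₀ x S) (subB P x S) A∈c
...   | M₁ , M₁∈ , P₁ , P₁∈ , refl with sub-lsub⁻ x≢y M (∈-concatMap⁺ (λ c → sub c x S) M₀∈ M₁∈)
...     | M' , M'∈ , p' , p'∈ , A' , A'∈ , A'≅ =
          lin M' ∷ P₁ , ∈-productWith⁺ lin∷ M'∈ P₁∈ , p' , p'∈ , lin A' ∷ P₁ , lsubB-lin⁺ʰ A'∈ , lin A'≅ ∷ ≅ᵦ-refl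
subB-lsubB⁻ {x} {y} x≢y (lin M ∷ P) {p} {S} A∈ | c , c∈ , A∈c | inj₂ (P₀ , P₀∈ , refl)
  with ∈-productWith⁻ lin∷ (sub M x S) (subB P₀ x S) A∈c
...   | M₁ , M₁∈ , P₁ , P₁∈ , refl with subB-lsubB⁻ x≢y P (∈-concatMap⁺ (λ c → subB c x S) P₀∈ P₁∈)
...     | P' , P'∈ , p' , p'∈ , A' , A'∈ , A'≅ =
          lin M₁ ∷ P' , ∈-productWith⁺ lin∷ M₁∈ P'∈ , p' , p'∈ , lin M₁ ∷ A' , lsubB-∷⁺ᵗ A'∈ , ≅ᵣ-refl ∷ A'≅
subB-lsubB⁻ {x} {y} x≢y (bang R ∷ P) {p} {S} A∈ with ∈-concatMap⁻ (λ c → subB c x S) (lsubB (bang R ∷ P) y p) A∈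
... | c , c∈ , A∈c with lsubB-∷⁻ {y} {p} {bang R} {P} c∈
... | inj₁ (R₀ , R₀∈ , refl) with ∈-productWith⁻ lin∷ (sub R₀ x S) (subB (bang R ∷ P) x S) A∈c
...   | R₁ , R₁∈ , B₁ , B₁∈ , refl with ∈-map⁻ (λ P' → map bang (sub R x S) ++ P') B₁∈
...   | P₁ , P₁∈ , refl with sub-lsub⁻ x≢y R (∈-concatMap⁺ (λ c → sub c x S) R₀∈ R₁∈)
...   | R' , R'∈ , p' , p'∈ , A' , A'∈ , A'≅ with lsubB-bangs⁺ʰ (sub R x S) P₁ R'∈ A'∈
...   | Z , Z∈ , Z≅ = map bang (sub R x S) ++ P₁ , B₁∈ , p' , p'∈ , Z , Z∈ , trans Z≅ (lin A'≅ ∷ ≅ᵦ-refl)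
subB-lsubB⁻ {x} {y} x≢y (bang R ∷ P) {p} {S} A∈ | c , c∈ , A∈c | inj₂ (P₀ , P₀∈ , refl)
  with ∈-map⁻ (λ P' → map bang (sub R x S) ++ P') A∈c
...   | P₁ , P₁∈ , refl with subB-lsubB⁻ x≢y P (∈-concatMap⁺ (λ c → subB c x S) P₀∈ P₁∈)
...     | P' , P'∈ , p' , p'∈ , A' , A'∈ , A'≅ =
          map bang (sub R x S) ++ P' , ∈-map⁺ (λ P' → map bang (sub R x S) ++ P') P'∈ , p' , p'∈
          , map bang (sub R x S) ++ A' , lsubB-bangs⁺ᵗ (sub R x S) P' A'∈ , ≅ᵦ-++ˡ _ A'≅

lsubBag-++ : ∀ A y B C → lsubBag A y (B ++ C) ≡ concatMap (λ A' → lsubBag A' y C) (lsubBag A y B)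
lsubBag-++ A y [] C      = sym (++-identityʳ (lsubBag A y C))
lsubBag-++ A y (r ∷ B) C =
  ≡-trans (concatMap-cong (λ A' → lsubBag-++ A' y B C) (lsubR A y r))
          (sym (concatMap-assoc (λ A' → lsubBag A' y C) (λ A' → lsubBag A' y B) (lsubR A y r)))

lsubBag-via : ∀ {X A A' w v y} B → A ∈ X → A ≅ A' → w ∈ lsubBag A' y B → w ≅ v →
  Σ Term (λ w' → w' ∈ concatMap (λ A → lsubBag A y B) X × w' ≅ v)
lsubBag-via {y = y} B A∈ A≅A' w∈ w≅v with lsubBag-resp-≅ B (≅-sym A≅A') w∈
... | w' , w'∈ , w≅w' = w' , ∈-concatMap⁺ (λ A → lsubBag A y B) A∈ w'∈ , ≅-trans (≅-sym w≅w') w≅v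

lsubs-bang⁻ : ∀ {x y} N p {t} → x ≢ y → t ∈ lsubs (p ∷ var y ∷ []) x N → t ∈ lsub p x N
lsubs-bang⁻ {x} {y} N p x≢y t∈ with ∈-++⁻ (lsub p x N) t∈
... | inj₁ t∈p = t∈p
... | inj₂ t∈y rewrite ≢⇒≡ᵇ-false (λ (y≡x : y ≡ x) → x≢y (sym y≡x)) with t∈y
...   | ()

lsubBag-lsub⁻ : ∀ {x y N} → x ≢ y → occ y N ≡ false → ∀ B M {u v} → occB y B ≡ false →
  u ∈ lsubBag M y B → v ∈ lsub u x N →
  Σ Term (λ M' → M' ∈ lsub M x N × Σ Term (λ w → w ∈ lsubBag M' y B × w ≅ v))
  ⊎ Σ Bag (λ B' → B' ∈ lsubB B x N × Σ Term (λ w → w ∈ lsubBag M y B' × w ≅ v))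
lsubBag-lsub⁻ x≢y y∉N [] M y∉B (here refl) v∈ = inj₁ (_ , v∈ , _ , here refl , ≅-refl)
lsubBag-lsub⁻ {x} {y} {N} x≢y y∉N (r ∷ B) M {v = v} y∉B u∈ v∈ with ∨-false⁻ {occR y r} y∉B
... | y∉r , y∉B' with ∈-concatMap⁻ (λ A → lsubBag A y B) (lsubR M y r) u∈
... | A , A∈ , u∈A with lsubBag-lsub⁻ x≢y y∉N B A y∉B' u∈A v∈
...   | inj₂ (B' , B'∈ , w , w∈ , w≅v) = inj₂ (r ∷ B' , lsubB-∷⁺ᵗ B'∈ , w , ∈-concatMap⁺ (λ A → lsubBag A y B') A∈ w∈ , w≅v)
...   | inj₁ (A' , A'∈ , w , w∈ , w≅v) = head r y∉r (∈-concatMap⁺ (λ a → lsub a x N) A∈ A'∈)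
  where
  head : ∀ r → occR y r ≡ false → A' ∈ lsubs (lsubR M y r) x N →
    Σ Term (λ M' → M' ∈ lsub M x N × Σ Term (λ w → w ∈ lsubBag M' y (r ∷ B) × w ≅ v))
    ⊎ Σ Bag (λ B' → B' ∈ lsubB (r ∷ B) x N × Σ Term (λ w → w ∈ lsubBag M y B' × w ≅ v))
  head (lin p) _ A'∈' with lsub-lsub⁻ M A'∈'
  ... | A'' , in-M {M'} M'∈ A''∈ , A''≅ = inj₁ (M' , M'∈ , lsubBag-via B A''∈ A''≅ w∈ w≅v)
  ... | A'' , in-p {p'} p'∈ A''∈ , A''≅ = inj₂ (lin p' ∷ B , lsubB-lin⁺ʰ p'∈ , lsubBag-via B A''∈ A''≅ w∈ w≅v)
  head (bang p) y∉p A'∈' with lsub-sub⁻ x≢y M (p ∷ var y ∷ []) N y∉N (λ t∈ → occ-lsub p y∉p y∉N (lsubs-bang⁻ N p x≢y t∈)) A'∈'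
  ... | V , in-A V∈ , l , l∈ , l≅ = inj₁ (V , V∈ , lsubBag-via B l∈ l≅ w∈ w≅v)
  ... | V , in-T {t} t∈ V∈ , l , l∈ , l≅ with lsubBag-via B l∈ l≅ w∈ w≅v
  ...   | w' , w'∈ , w'≅v =
          inj₂ (lin t ∷ bang p ∷ B , lsubB-bang⁺ʰ (lsubs-bang⁻ N p x≢y t∈) , w'
               , ∈-concatMap⁺ (λ A → lsubBag A y (bang p ∷ B)) V∈ w'∈ , w'≅v)

sub-id  : ∀ A y → sub A y (var y ∷ []) ≡ A ∷ []
subB-id : ∀ P y → subB P y (var y ∷ []) ≡ P ∷ []
sub-id (var z) y with ≡ᵇ-view z y
... | eq refl e rewrite e = refl
... | ne _ e rewrite e    = refl
sub-id (lam A) y rewrite sub-id A (suc y) = refl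
sub-id (app M P) y rewrite sub-id M y | subB-id P y = refl
subB-id [] y = refl
subB-id (lin M ∷ P) y rewrite sub-id M y | subB-id P y  = refl
subB-id (bang M ∷ P) y rewrite sub-id M y | subB-id P y = refl

-- A{q₁ + ⋯ + qₖ + y/y} is the composite of the substitutions A⟨qᵢ^!/y⟩ = A{qᵢ + y/y}
sub-bangs⇒lsubBag : ∀ {y} qs A {a} → (∀ {q} → q ∈ qs → occ y q ≡ false) → a ∈ sub A y (qs ++ var y ∷ []) →
  Σ Term (λ b → b ∈ lsubBag A y (map bang qs) × b ≅ a)
sub-bangs⇒lsubBag {y} [] A fresh a∈ rewrite sub-id A y with a∈
... | here refl = A , here refl , ≅-refl
sub-bangs⇒lsubBag {y} (q ∷ qs) A fresh a∈
  with ∈-resp-↭ a∈ (≈.↭-sym (≈.↭-trans (sub-sub A y (q ∷ var y ∷ []) (qs ++ var y ∷ [])) (≈.↭-reflexive (cong (sub A y) composite))))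
  where
  composite : subs (q ∷ var y ∷ []) y (qs ++ var y ∷ []) ≡ q ∷ qs ++ var y ∷ []
  composite rewrite sub-fresh q (qs ++ var y ∷ []) (fresh (here refl)) | ≡ᵇ-refl y = cong (q ∷_) (++-identityʳ _)
... | a' , a'∈ , a≅a' with ∈-concatMap⁻ (λ A' → sub A' y (qs ++ var y ∷ [])) (sub A y (q ∷ var y ∷ [])) a'∈
... | A' , A'∈ , a'∈A' with sub-bangs⇒lsubBag qs A' (λ q∈ → fresh (there q∈)) a'∈A'
... | b , b∈ , b≅a' = b , ∈-concatMap⁺ (λ A' → lsubBag A' y (map bang qs)) A'∈ b∈ , ≅-trans b≅a' (≅-sym a≅a')

lsubBag-sub⁻ : ∀ {x y S} → x ≢ y → (∀ {s} → s ∈ S → occ y s ≡ false) → ∀ B M {u v} → occB y B ≡ false →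
  u ∈ lsubBag M y B → v ∈ sub u x S →
  Σ Term (λ M' → M' ∈ sub M x S × Σ Bag (λ B' → B' ∈ subB B x S × Σ Term (λ w → w ∈ lsubBag M' y B' × w ≅ v)))
lsubBag-sub⁻ x≢y y∉S [] M y∉B (here refl) v∈ = _ , v∈ , [] , here refl , _ , here refl , ≅-refl
lsubBag-sub⁻ {x} {y} {S} x≢y y∉S (r ∷ B) M {v = v} y∉B u∈ v∈ with ∨-false⁻ {occR y r} y∉B
... | y∉r , y∉B' with ∈-concatMap⁻ (λ A → lsubBag A y B) (lsubR M y r) u∈
... | A , A∈ , u∈A with lsubBag-sub⁻ x≢y y∉S B A y∉B' u∈A v∈
... | A' , A'∈ , B' , B'∈ , w , w∈ , w≅v = head r y∉r (∈-concatMap⁺ (λ a → sub a x S) A∈ A'∈)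
  where
  head : ∀ r → occR y r ≡ false → A' ∈ subs (lsubR M y r) x S →
    Σ Term (λ M' → M' ∈ sub M x S × Σ Bag (λ B' → B' ∈ subB (r ∷ B) x S × Σ Term (λ w → w ∈ lsubBag M' y B' × w ≅ v)))
  head (lin p) _ A'∈' with sub-lsub⁻ x≢y M A'∈'
  ... | M' , M'∈ , p' , p'∈ , A'' , A''∈ , A''≅ =
        M' , M'∈ , lin p' ∷ B' , ∈-productWith⁺ lin∷ p'∈ B'∈ , lsubBag-via B' A''∈ A''≅ w∈ w≅v
  head (bang p) y∉p A'∈' with ∈-resp-↭ A'∈' (sub-sub-comm x≢y M S (p ∷ var y ∷ []) y∉S)
  ... | A'' , A''∈ , A'≅A'' with ∈-concatMap⁻ (λ a → sub a y (subs (p ∷ var y ∷ []) x S)) (sub M x S) A''∈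
  ... | M' , M'∈ , A''∈M'
    with sub-bangs⇒lsubBag (sub p x S) M' (occ-sub p y∉p y∉S) (subst (λ T → A'' ∈ sub M' y T) bangs A''∈M')
    where
    bangs : subs (p ∷ var y ∷ []) x S ≡ sub p x S ++ var y ∷ []
    bangs rewrite sub-var-≢ {y} {x} S (λ y≡x → x≢y (sym y≡x)) = refl
  ... | A₃ , A₃∈ , A₃≅A'' with lsubBag-via B' A₃∈ (≅-trans A₃≅A'' (≅-sym A'≅A'')) w∈ w≅v
  ... | w' , w'∈ , w'≅v =
        M' , M'∈ , map bang (sub p x S) ++ B' , ∈-map⁺ (λ P → map bang (sub p x S) ++ P) B'∈
        , w' , subst (w' ∈_) (sym (lsubBag-++ M' y (map bang (sub p x S)) B')) w'∈ , w'≅v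

betaSum⁻ : ∀ M P {L} → L ∈ betaSum M P →
  Σ Term (λ u → u ∈ lsubBag M 0 (shiftB 0 P) × Σ Term (λ t → t ∈ sub u 0 [] × L ≡ lower 0 t))
betaSum⁻ M P L∈ with ∈-map⁻ (lower 0) L∈
... | t , t∈ , refl with ∈-concatMap⁻ (λ A → sub A 0 []) (lsubBag M 0 (shiftB 0 P)) t∈
... | u , u∈ , t∈u = u , u∈ , t , t∈u , refl

betaSum⁺ : ∀ M P {u t} → u ∈ lsubBag M 0 (shiftB 0 P) → t ∈ sub u 0 [] → lower 0 t ∈ betaSum M P
betaSum⁺ M P u∈ t∈ = ∈-map⁺ (lower 0) (∈-concatMap⁺ (λ A → sub A 0 []) u∈ t∈)

betaSum⁺-≅ : ∀ M P {u v l l₀} → u ∈ lsubBag M 0 (shiftB 0 P) → u ≅ v → l ∈ sub v 0 [] → l ≅ l₀ →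
  Σ Term (λ L → L ∈ betaSum M P × L ≅ lower 0 l₀)
betaSum⁺-≅ M P u∈ u≅v l∈ l≅l₀ with sub-resp-≅ (≅-sym u≅v) l∈
... | l' , l'∈ , l≅l' = lower 0 l' , betaSum⁺ M P u∈ l'∈ , lower-cong 0 (≅-trans (≅-sym l≅l') l≅l₀)

betaSum-lsub⁻ : ∀ M P {x N L} → L ∈ lsubs (betaSum M P) x N →
  Σ Term (λ M' → M' ∈ lsub M (suc x) (shift 0 N) × Σ Term (λ L' → L' ∈ betaSum M' P × L' ≅ L))
  ⊎ Σ Bag (λ P' → P' ∈ lsubB P x N × Σ Term (λ L' → L' ∈ betaSum M P' × L' ≅ L))
betaSum-lsub⁻ M P {x} {N} L∈ with ∈-concatMap⁻ (λ a → lsub a x N) (betaSum M P) L∈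
... | L₀ , L₀∈ , L∈L₀ with betaSum⁻ M P L₀∈
... | u , u∈ , t , t∈ , refl with ∈-map⁻ (lower 0) (subst (_ ∈_) (lsub-lower z≤n t N (occ-sub-self u (λ ()) t∈)) L∈L₀)
... | l , l∈ , refl
  with lsub-sub⁻ 1+n≢0 u [] (shift 0 N) (occ-shift-self 0 N) (λ ()) (∈-concatMap⁺ (λ a → lsub a (suc x) (shift 0 N)) t∈ l∈)
... | v , in-T () _ , _
... | v , in-A v∈ , l' , l'∈ , l'≅l
  with lsubBag-lsub⁻ 1+n≢0 (occ-shift-self 0 N) (shiftB 0 P) M (occB-shift-self 0 P) u∈ v∈
...   | inj₁ (M' , M'∈ , w , w∈ , w≅v) = inj₁ (M' , M'∈ , betaSum⁺-≅ M' P w∈ w≅v l'∈ l'≅l)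
...   | inj₂ (B' , B'∈ , w , w∈ , w≅v) with ∈-map⁻ (shiftB 0) (subst (B' ∈_) (lsubB-shift z≤n P N) B'∈)
...     | P' , P'∈ , refl = inj₂ (P' , P'∈ , betaSum⁺-≅ M P' w∈ w≅v l'∈ l'≅l)

betaSum-sub⁻ : ∀ M P {x S L} → L ∈ subs (betaSum M P) x S →
  Σ Term (λ M' → M' ∈ sub M (suc x) (map (shift 0) S) ×
    Σ Bag (λ P' → P' ∈ subB P x S × Σ Term (λ L' → L' ∈ betaSum M' P' × L' ≅ L)))
betaSum-sub⁻ M P {x} {S} L∈ with ∈-concatMap⁻ (λ a → sub a x S) (betaSum M P) L∈
... | L₀ , L₀∈ , L∈L₀ with betaSum⁻ M P L₀∈
... | u , u∈ , t , t∈ , refl with ∈-map⁻ (lower 0) (subst (_ ∈_) (sub-lower z≤n t S (occ-sub-self u (λ ()) t∈)) L∈L₀)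
... | l , l∈ , refl
  with ∈-resp-↭ (∈-concatMap⁺ (λ a → sub a (suc x) (map (shift 0) S)) t∈ l∈)
                (sub-sub-comm 1+n≢0 u (map (shift 0) S) [] (shift₀-avoids-0 S))
... | l' , l'∈ , l≅l' with ∈-concatMap⁻ (λ a → sub a 0 []) (sub u (suc x) (map (shift 0) S)) l'∈
... | v , v∈ , l'∈v with lsubBag-sub⁻ 1+n≢0 (shift₀-avoids-0 S) (shiftB 0 P) M (occB-shift-self 0 P) u∈ v∈
... | M' , M'∈ , B' , B'∈ , w , w∈ , w≅v with ∈-map⁻ (shiftB 0) (subst (B' ∈_) (subB-shift z≤n P S) B'∈)
... | P' , P'∈ , refl = M' , M'∈ , P' , P'∈ , betaSum⁺-≅ M' P' w∈ w≅v l'∈v (≅-sym l≅l')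

-- Simulation of reductions through substitutions

ReducesTo : Sum → Term → Set
ReducesTo X L = Σ Term (λ K → K ∈ X × Σ Term (λ K' → (K →o K') × (K' ≅ L)))

ReducesToᵦ : SumB → Bag → Set
ReducesToᵦ X L = Σ Bag (λ K → K ∈ X × Σ Bag (λ K' → (K →oᵦ K') × (K' ≅ᵦ L)))

lsub-sim  : ∀ {O O'} → O →o O' → ∀ {x N L} → L ∈ lsub O' x N → ReducesTo (lsub O x N) L
lsubB-sim : ∀ {P P'} → P →oᵦ P' → ∀ {x N L} → L ∈ lsubB P' x N → ReducesToᵦ (lsubB P x N) L
lsub-sim (β {M} {P} R∈) {x} {N} L∈ with betaSum-lsub⁻ M P (∈-concatMap⁺ (λ a → lsub a x N) R∈ L∈)
... | inj₁ (M' , M'∈ , L' , L'∈ , L'≅) = app (lam M') P , lsub-app⁺ˡ (∈-map⁺ lam M'∈) , L' , β L'∈ , L'≅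
... | inj₂ (P' , P'∈ , L' , L'∈ , L'≅) = app (lam M) P' , lsub-app⁺ʳ P'∈ , L' , β L'∈ , L'≅
lsub-sim (lamᶜ r) L∈ with ∈-map⁻ lam L∈
... | L₀ , L₀∈ , refl with lsub-sim r L₀∈
... | K , K∈ , K' , K→K' , K'≅ = lam K , ∈-map⁺ lam K∈ , lam K' , lamᶜ K→K' , lam K'≅
lsub-sim (appˡ {M} {M'} {P} r) {x} {N} L∈ with lsub-app⁻ {x} {N} {M'} {P} L∈
... | inj₁ (M₀ , M₀∈ , refl) with lsub-sim r M₀∈
...   | K , K∈ , K' , K→K' , K'≅ = app K P , lsub-app⁺ˡ K∈ , app K' P , appˡ K→K' , app K'≅ ≅ᵦ-refl
lsub-sim (appˡ {M} {M'} {P} r) L∈ | inj₂ (P₀ , P₀∈ , refl) = app M P₀ , lsub-app⁺ʳ P₀∈ , app M' P₀ , appˡ r , ≅-refl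
lsub-sim (appʳ {M} {P} {Q} r) {x} {N} L∈ with lsub-app⁻ {x} {N} {M} {Q} L∈
... | inj₁ (M₀ , M₀∈ , refl) = app M₀ P , lsub-app⁺ˡ M₀∈ , app M₀ Q , appʳ r , ≅-refl
... | inj₂ (Q₀ , Q₀∈ , refl) with lsubB-sim r Q₀∈
...   | K , K∈ , K' , K→K' , K'≅ = app M K , lsub-app⁺ʳ K∈ , app M K' , appʳ K→K' , app ≅-refl K'≅
lsubB-sim (here {M} {M'} {P} r) {x} {N} L∈ with lsubB-∷⁻ {x} {N} {lin M'} {P} L∈
... | inj₁ (M₀ , M₀∈ , refl) with lsub-sim r M₀∈
...   | K , K∈ , K' , K→K' , K'≅ = lin K ∷ P , lsubB-lin⁺ʰ K∈ , lin K' ∷ P , here K→K' , lin K'≅ ∷ ≅ᵦ-refl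
lsubB-sim (here {M} {M'} {P} r) L∈ | inj₂ (P₀ , P₀∈ , refl) = lin M ∷ P₀ , lsubB-∷⁺ᵗ P₀∈ , lin M' ∷ P₀ , here r , ≅ᵦ-refl
lsubB-sim (there {lin R} {P} {Q} r) {x} {N} L∈ with lsubB-∷⁻ {x} {N} {lin R} {Q} L∈
... | inj₁ (R₀ , R₀∈ , refl) = lin R₀ ∷ P , lsubB-lin⁺ʰ R₀∈ , lin R₀ ∷ Q , there r , ≅ᵦ-refl
... | inj₂ (Q₀ , Q₀∈ , refl) with lsubB-sim r Q₀∈
...   | K , K∈ , K' , K→K' , K'≅ = lin R ∷ K , lsubB-∷⁺ᵗ K∈ , lin R ∷ K' , there K→K' , ≅ᵣ-refl ∷ K'≅
lsubB-sim (there {bang R} {P} {Q} r) {x} {N} L∈ with lsubB-∷⁻ {x} {N} {bang R} {Q} L∈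
... | inj₁ (R₀ , R₀∈ , refl) = lin R₀ ∷ bang R ∷ P , lsubB-bang⁺ʰ R₀∈ , lin R₀ ∷ bang R ∷ Q , there (there r) , ≅ᵦ-refl
... | inj₂ (Q₀ , Q₀∈ , refl) with lsubB-sim r Q₀∈
...   | K , K∈ , K' , K→K' , K'≅ = bang R ∷ K , lsubB-∷⁺ᵗ K∈ , bang R ∷ K' , there K→K' , ≅ᵣ-refl ∷ K'≅

there-++ : ∀ X {P Q} → P →oᵦ Q → (X ++ P) →oᵦ (X ++ Q)
there-++ []      r = r
there-++ (x ∷ X) r = there (there-++ X r)

sub-sim  : ∀ {O O'} → O →o O' → ∀ {x S L} → L ∈ sub O' x S → ReducesTo (sub O x S) L
subB-sim : ∀ {P P'} → P →oᵦ P' → ∀ {x S L} → L ∈ subB P' x S → ReducesToᵦ (subB P x S) L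
sub-sim (β {M} {P} R∈) {x} {S} L∈ with betaSum-sub⁻ M P (∈-concatMap⁺ (λ a → sub a x S) R∈ L∈)
... | M' , M'∈ , P' , P'∈ , L' , L'∈ , L'≅ = app (lam M') P' , ∈-productWith⁺ app (∈-map⁺ lam M'∈) P'∈ , L' , β L'∈ , L'≅
sub-sim (lamᶜ r) L∈ with ∈-map⁻ lam L∈
... | L₀ , L₀∈ , refl with sub-sim r L₀∈
... | K , K∈ , K' , K→K' , K'≅ = lam K , ∈-map⁺ lam K∈ , lam K' , lamᶜ K→K' , lam K'≅
sub-sim (appˡ {M} {M'} {P} r) {x} {S} L∈ with ∈-productWith⁻ app (sub M' x S) (subB P x S) L∈
... | M₀ , M₀∈ , P₀ , P₀∈ , refl with sub-sim r M₀∈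
... | K , K∈ , K' , K→K' , K'≅ = app K P₀ , ∈-productWith⁺ app K∈ P₀∈ , app K' P₀ , appˡ K→K' , app K'≅ ≅ᵦ-refl
sub-sim (appʳ {M} {P} {Q} r) {x} {S} L∈ with ∈-productWith⁻ app (sub M x S) (subB Q x S) L∈
... | M₀ , M₀∈ , Q₀ , Q₀∈ , refl with subB-sim r Q₀∈
... | K , K∈ , K' , K→K' , K'≅ = app M₀ K , ∈-productWith⁺ app M₀∈ K∈ , app M₀ K' , appʳ K→K' , app ≅-refl K'≅
subB-sim (here {M} {M'} {P} r) {x} {S} L∈ with ∈-productWith⁻ lin∷ (sub M' x S) (subB P x S) L∈
... | M₀ , M₀∈ , P₀ , P₀∈ , refl with sub-sim r M₀∈
... | K , K∈ , K' , K→K' , K'≅ =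
      lin K ∷ P₀ , ∈-productWith⁺ lin∷ K∈ P₀∈ , lin K' ∷ P₀ , here K→K' , lin K'≅ ∷ ≅ᵦ-refl
subB-sim (there {lin R} {P} {Q} r) {x} {S} L∈ with ∈-productWith⁻ lin∷ (sub R x S) (subB Q x S) L∈
... | R₀ , R₀∈ , Q₀ , Q₀∈ , refl with subB-sim r Q₀∈
... | K , K∈ , K' , K→K' , K'≅ =
      lin R₀ ∷ K , ∈-productWith⁺ lin∷ R₀∈ K∈ , lin R₀ ∷ K' , there K→K' , ≅ᵣ-refl ∷ K'≅
subB-sim (there {bang R} {P} {Q} r) {x} {S} L∈ with ∈-map⁻ (λ P' → map bang (sub R x S) ++ P') L∈
... | Q₀ , Q₀∈ , refl with subB-sim r Q₀∈
... | K , K∈ , K' , K→K' , K'≅ =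
      map bang (sub R x S) ++ K , ∈-map⁺ (λ P' → map bang (sub R x S) ++ P') K∈
      , map bang (sub R x S) ++ K' , there-++ (map bang (sub R x S)) K→K' , ≅ᵦ-++ˡ _ K'≅

lsubR-sim : ∀ {O O'} → O →o O' → ∀ {x} r {L} → L ∈ lsubR O' x r → ReducesTo (lsubR O x r) L
lsubR-sim O→O' (lin N) L∈  = lsub-sim O→O' L∈
lsubR-sim O→O' (bang N) L∈ = sub-sim O→O' L∈

substBag0-∷ : ∀ O x r Q → substBag0 O x (r ∷ Q) ≡ concatMap (λ A → substBag0 A x Q) (lsubR O x r)
substBag0-∷ O x r Q = concatMap-assoc (λ A → sub A x []) (λ A → lsubBag A x Q) (lsubR O x r)

substBag0-sim : ∀ Q {O O' x} → O →o O' → ∀ {L} → L ∈ substBag0 O' x Q → ReducesTo (substBag0 O x Q) L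
substBag0-sim [] {O} {O'} {x} O→O' L∈ with ∈-++⁻ (sub O' x []) L∈
... | inj₁ L∈' with sub-sim O→O' L∈'
...   | K , K∈ , K' , K→K' , K'≅ = K , ∈-++⁺ˡ K∈ , K' , K→K' , K'≅
substBag0-sim [] O→O' L∈ | inj₂ ()
substBag0-sim (r ∷ Q) {O} {O'} {x} O→O' {L} L∈
  with ∈-concatMap⁻ (λ A → substBag0 A x Q) (lsubR O' x r) (subst (L ∈_) (substBag0-∷ O' x r Q) L∈)
... | A' , A'∈ , L∈A' with lsubR-sim O→O' r A'∈
... | A , A∈ , A₁ , A→A₁ , A₁≅A' with substBag0-resp-≅ Q (≅-sym A₁≅A') L∈A'
... | L₁ , L₁∈ , L≅L₁ with substBag0-sim Q A→A₁ L₁∈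
... | K , K∈ , K' , K→K' , K'≅L₁ =
      K , subst (K ∈_) (sym (substBag0-∷ O x r Q)) (∈-concatMap⁺ (λ A → substBag0 A x Q) A∈ K∈) , K' , K→K'
      , ≅-trans K'≅L₁ (≅-sym L≅L₁)

lemma3p7 : (O O' : Term) (Q : Bag) (x : ℕ) → occB x Q ≡ false → O →o O' →
    (L' : Term) → L' ∈ substBag0 O' x Q →
    Σ Term (λ L → L ∈ substBag0 O x Q × Σ Term (λ L'' → (L →o L'') × (L'' ≅ L')))
lemma3p7 O O' Q x _ O→O' L' L'∈ = substBag0-sim Q O→O' L'∈
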